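{- Let $G$ be an $(s,k)$-edge-connected graph such that $k\geq 2$ and $\deg(s)\geq 4$. Let $I_1,I_2,I_3$ be consecutive vertices (in this order) of a path or of a $3$-cycle in $I(L(G,s,k))$, and let $A_1,A_2,A_3$ be dangerous sets such that $A_i$ contains the end other than $s$ of every edge of $I_i$. Then: (1) $|\delta(\{s\}:A_i\cap A_2)|=1$ for $i=1,3$; (2) $\delta(A_2)=\delta(A_2\cap A_1:A_1\setminus A_2)\cup\delta(\{s\}:A_2)\cup\delta(A_2\cap A_3:A_3\setminus A_2)$; (3) $|I_2|=2$; (4) $A_2\setminus(A_1\cup A_3)=\emptyset$; (5) $|\delta(A_1\cap A_2:A_2\cap A_3)|=(k-1)/2$.
   Context: All graphs are finite loopless multigraphs. $\delta(X)$ is the set of edges with exactly one end in $X$; for disjoint $X,Y$, $\delta(X:Y)$ is the set of edges with one end in $X$ and the other in $Y$. A graph $G$ is $(s,k)$-edge-connected if $G$ has at least three vertices, $s\in V(G)$, $k$ is a positive integer, and any two vertices of $G$ different from $s$ are joined by $k$ pairwise edge-disjoint paths in $G$ (which may pass through $s$). Lifting edges $sv,sw$ means deleting them and adding $vw$ if $v\ne w$, only deleting them if $v=w$; result $G_{v,w}$. $sv,sw$ are $k$-liftable if $G_{v,w}$ is $(s,k)$-edge-connected. $L(G,s,k)$ has vertex set the edges at $s$, adjacent iff $k$-liftable. A set $A\subseteq V(G)\setminus\{s\}$ is dangerous if $A\ne\emptyset$, $V(G)\setminus(A\cup\{s\})\neq\emptyset$ and $|\delta(A)|\le k+1$. The independence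 graph $I(H)$ has as vertices the maximal independent sets of $H$, two adjacent iff they intersect. -}

module Defs where

open import Data.Nat using (ℕ; zero; suc; _+_; _*_; _≤_)
open import Data.Bool using (Bool; true; false; not; _∧_; _∨_; _xor_; if_then_else_)
open import Data.Fin using (Fin; _≟_)
open import Data.Fin.Subset using (Subset; _∈_; _∉_; _⊆_; Nonempty; ⁅_⁆)
open import Data.List using (List; []; _∷_; [_]; length; map; filterᵇ; allFin; _++_; lookup)
open import Data.List.Membership.Propositional using () renaming (_∈_ to _∈ₗ_; _∉_ to _∉ₗ_)
open import Data.List.Relation.Unary.Unique.Propositional using (Unique)
open import Data.Product using (Σ; ∃; _×_; _,_; proj₁; proj₂)
open import Data.Sum using (_⊎_)
open import Data.Vec as Vec using ()
open import Relation.Binary.PropositionalEquality using (_≡_; _≢_)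
open import Relation.Nullary using (¬_)
open import Relation.Nullary.Decidable using (⌊_⌋)

-- Finite multigraphs.  Vertices are Fin n; the edges form a list of
-- (ordered) end pairs, an edge being identified by its position in the
-- list (so parallel edges are distinct edges).

record Graph : Set where
  constructor mkGraph
  field
    n     : ℕ
    edges : List (Fin n × Fin n)

open Graph public

Vertex : Graph → Set
Vertex G = Fin (n G)

Edge : Graph → Set
Edge G = Fin (length (edges G))

ends : (G : Graph) → Edge G → Vertex G × Vertex G
ends G e = lookup (edges G) e

Loopless : Graph → Set
Loopless G = ∀ e → proj₁ (ends G e) ≢ proj₂ (ends G e)

_==_ : ∀ {m} → Fin m → Fin m → Bool
x == y = ⌊ x ≟ y ⌋

Joins : (G : Graph) → Edge G → Vertex G → Vertex G → Set
Joins G e u w = ends G e ≡ (u , w) ⊎ ends G e ≡ (w , u)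

data Walk (G : Graph) : Vertex G → Vertex G → Set where
  []   : ∀ {u} → Walk G u u
  step : ∀ {u w v} (e : Edge G) → Joins G e u w → Walk G w v → Walk G u v

walkVerts : ∀ {G u v} → Walk G u v → List (Vertex G)
walkVerts {u = u} []           = u ∷ []
walkVerts {u = u} (step e _ p) = u ∷ walkVerts p

walkEdges : ∀ {G u v} → Walk G u v → List (Edge G)
walkEdges []           = []
walkEdges (step e _ p) = e ∷ walkEdges p

IsPath : ∀ {G u v} → Walk G u v → Set
IsPath p = Unique (walkVerts p)

EdgeDisjoint : ∀ {G u v} → Walk G u v → Walk G u v → Set
EdgeDisjoint p q = ∀ e → e ∈ₗ walkEdges p → e ∉ₗ walkEdges q

EdgeDisjointPaths : (G : Graph) → ℕ → Vertex G → Vertex G → Set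
EdgeDisjointPaths G k u v =
  Σ (Fin k → Walk G u v) λ P →
    (∀ i → IsPath (P i)) × (∀ i j → i ≢ j → EdgeDisjoint (P i) (P j))

SKConnected : (G : Graph) → Vertex G → ℕ → Set
SKConnected G s k =
  3 ≤ n G × 1 ≤ k ×
  (∀ u v → u ≢ s → v ≢ s → u ≢ v → EdgeDisjointPaths G k u v)

atB : (G : Graph) → Vertex G → Edge G → Bool
atB G s e = (proj₁ (ends G e) == s) ∨ (proj₂ (ends G e) == s)

At : (G : Graph) → Vertex G → Edge G → Set
At G s e = atB G s e ≡ true

deg : (G : Graph) → Vertex G → ℕ
deg G s = length (filterᵇ (atB G s) (allFin _))

other : (G : Graph) → Vertex G → Edge G → Vertex G
other G s e = if proj₁ (ends G e) == s then proj₂ (ends G e) else proj₁ (ends G e)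

lift : (G : Graph) → Vertex G → Edge G → Edge G → Graph
lift G s e f = mkGraph (n G)
  (map (lookup (edges G))
       (filterᵇ (λ i → not (i == e) ∧ not (i == f)) (allFin _))
   ++ (if v == w then [] else [ (v , w) ]))
  where
  v = other G s e
  w = other G s f

Liftable : (G : Graph) → Vertex G → ℕ → Edge G → Edge G → Set
Liftable G s k e f = SKConnected (lift G s e f) s k

-- adjacency in L(G,s,k) (vertex set: the edges at s)
LAdj : (G : Graph) → Vertex G → ℕ → Edge G → Edge G → Set
LAdj G s k e f = e ≢ f × At G s e × At G s f × Liftable G s k e f

ESet : Graph → Set
ESet G = Subset (length (edges G))

LVertexSet : (G : Graph) → Vertex G → ESet G → Set
LVertexSet G s I = ∀ e → e ∈ I → At G s e

Independent : (G : Graph) → Vertex G → ℕ → ESet G → Set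
Independent G s k I =
  LVertexSet G s I × (∀ e f → e ∈ I → f ∈ I → ¬ LAdj G s k e f)

-- maximal (under inclusion) independent set of L(G,s,k),
-- i.e. a vertex of I(L(G,s,k))
MaxIndependent : (G : Graph) → Vertex G → ℕ → ESet G → Set
MaxIndependent G s k I =
  Independent G s k I ×
  (∀ J → Independent G s k J → I ⊆ J → J ⊆ I)

VSet : Graph → Set
VSet G = Subset (n G)

memb : ∀ {m} → Subset m → Fin m → Bool
memb X v = Vec.lookup X v

cutB : (G : Graph) → VSet G → Edge G → Bool
cutB G X e = memb X (proj₁ (ends G e)) xor memb X (proj₂ (ends G e))

betweenB : (G : Graph) → VSet G → VSet G → Edge G → Bool
betweenB G X Y e =
  (memb X (proj₁ (ends G e)) ∧ memb Y (proj₂ (ends G e))) ∨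
  (memb X (proj₂ (ends G e)) ∧ memb Y (proj₁ (ends G e)))

cutSize : (G : Graph) → VSet G → ℕ
cutSize G X = length (filterᵇ (cutB G X) (allFin _))

betweenSize : (G : Graph) → VSet G → VSet G → ℕ
betweenSize G X Y = length (filterᵇ (betweenB G X Y) (allFin _))

_∖_ : ∀ {m} → Subset m → Subset m → Subset m
X ∖ Y = Vec.zipWith (λ a b → a ∧ not b) X Y

Dangerous : (G : Graph) → Vertex G → ℕ → VSet G → Set
Dangerous G s k A =
  s ∉ A × Nonempty A × (∃ λ v → v ≢ s × v ∉ A) × cutSize G A ≤ suc k

ContainsOtherEnds : (G : Graph) → Vertex G → ESet G → VSet G → Set
ContainsOtherEnds G s I A = ∀ e → e ∈ I → other G s e ∈ A

module Submission where

-- Classify every edge by the cells of its ends in the Venn diagram of {s}, A₁, A₂, A₃. The size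
-- of every cut or edge set δ(X:Y) between Boolean combinations of these sets is a sum over the
-- edges of a function of their type, so each linear identity or inequality between such sizes
-- (the counting arguments of the paper) holds as soon as it holds for each of the finitely many
-- edge types, which is decided by evaluation. The graph theory enters through three facts: a set
-- avoiding s that separates two vertices other than s has at least k boundary edges (Menger);
-- lifting two s-edges ending in X lowers |δ(X)| by two, so two s-edges ending in the same
-- dangerous set are never liftable and a maximal independent set whose edges end in a dangerous
-- set A contains every s-edge ending in A; and an s-edge adjacent to no edge of a maximal
-- independent set belongs to it. For two consecutive sets I, J with dangerous sets A, B these
-- force |δ(A)| = |δ(B)| = k + 1, |δ(A ∖ B)| = |δ(B ∖ A)| = k and a single s-edge into A ∩ B.
-- Comparing the pairs (I₁, I₂) and (I₃, I₂) shows first that A₁ ∩ A₂ ∖ A₃ and A₃ ∩ A₂ ∖ A₁ are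
-- non-empty, then that A₂ ∖ (A₁ ∪ A₃) and A₁ ∩ A₂ ∩ A₃ are empty, and the five claims follow.

open import Defs
open import Data.Nat using (ℕ; zero; suc; _+_; _*_; _≤_; _<_; z≤n; s≤s; _≤?_; _≤ᵇ_; _≡ᵇ_)
open import Data.Nat.Properties hiding (_≟_)
open import Data.Nat.Tactic.RingSolver using (solve-∀)
open import Data.Bool using (Bool; true; false; not; _∧_; _∨_; _xor_; if_then_else_; T)
open import Data.Bool.Properties using (∧-zeroʳ; ∨-zeroʳ; T-∧; T-not-≡; ¬-not)
import Data.Bool as Bool
open import Data.Fin using (Fin; zero; suc; punchIn; punchOut; _≟_)
open import Data.Fin.Properties
  using (punchIn-injective; punchInᵢ≢i; punchOut-injective; punchIn-punchOut; any?; ¬∀⟶∃¬)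
open import Data.Fin.Subset using (Subset; _∈_; _∉_; _⊆_; _∩_; _∪_; ∁; ⁅_⁆; ⊥; ∣_∣; Nonempty)
import Data.Fin.Subset as Subset
open import Data.Fin.Subset.Properties
  using (_∈?_; ⊆-antisym; x∈p∪q⁻; x∈p∩q⁻; p⊆p∪q; q⊆p∪q; x∈⁅x⁆; x∈⁅y⁆⇒x≡y; Empty-unique)
open import Data.List using (List; []; _∷_; [_]; length; filterᵇ; allFin; tabulate; map; _++_; lookup)
open import Data.List.Membership.Propositional using () renaming (_∈_ to _∈ₗ_)
open import Data.List.Relation.Unary.Any using (here; there)
open import Data.Vec using (Vec; []; _∷_)
import Data.Vec as Vec
open import Data.Vec.Relation.Unary.All using (All; []; _∷_)
open import Data.Vec.Properties
  using (lookup-zipWith; lookup-replicate; lookup-map; []=⇒lookup; lookup⇒[]=; lookup∘tabulate)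
open import Data.Product using (Σ; ∃; _×_; _,_; proj₁; proj₂)
open import Data.Sum using (_⊎_; inj₁; inj₂; swap)
open import Data.Unit using (tt)
import Data.Empty as Empty
open import Data.Empty using (⊥-elim)
open import Function using (Injective; Equivalence)
open import Relation.Nullary using (¬_; Dec; yes; no)
open import Relation.Binary.PropositionalEquality using (_≡_; _≢_)
open import Relation.Binary.PropositionalEquality hiding ([_])
open import Algebra.Properties.CommutativeMonoid.Sum +-0-commutativeMonoid
  using (sum; sum-cong-≗; ∑-distrib-+; sum-replicate-zero)

-- Finite sums and counting

𝟙 : Bool → ℕ
𝟙 true  = 1
𝟙 false = 0

sum-mono-≤ : ∀ {m} {f g : Fin m → ℕ} → (∀ i → f i ≤ g i) → sum f ≤ sum g
sum-mono-≤ {zero}  f≤g = z≤n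
sum-mono-≤ {suc m} f≤g = +-mono-≤ (f≤g zero) (sum-mono-≤ (λ i → f≤g (suc i)))

term≤sum : ∀ {m} (f : Fin m → ℕ) i → f i ≤ sum f
term≤sum {suc m} f zero    = m≤m+n (f zero) _
term≤sum {suc m} f (suc i) = ≤-trans (term≤sum (λ j → f (suc j)) i) (m≤n+m _ (f zero))

two-terms≤sum : ∀ {m} (f : Fin m → ℕ) {i j} → i ≢ j → f i + f j ≤ sum f
two-terms≤sum {suc m} f {zero}  {zero}  i≢j = ⊥-elim (i≢j refl)
two-terms≤sum {suc m} f {zero}  {suc j} i≢j = +-monoʳ-≤ (f zero) (term≤sum (λ l → f (suc l)) j)
two-terms≤sum {suc m} f {suc i} {zero}  i≢j =
  subst (_≤ sum f) (+-comm (f zero) (f (suc i))) (+-monoʳ-≤ (f zero) (term≤sum (λ l → f (suc l)) i))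
two-terms≤sum {suc m} f {suc i} {suc j} i≢j =
  ≤-trans (two-terms≤sum (λ l → f (suc l)) (λ eq → i≢j (cong suc eq))) (m≤n+m _ (f zero))

sum≡0⇒term≡0 : ∀ {m} (f : Fin m → ℕ) → sum f ≡ 0 → ∀ i → f i ≡ 0
sum≡0⇒term≡0 f sum≡0 i = n≤0⇒n≡0 (subst (f i ≤_) sum≡0 (term≤sum f i))

countᵇ : ∀ {A : Set} → (A → Bool) → List A → ℕ
countᵇ p xs = length (filterᵇ p xs)

countᵇ-tabulate : ∀ {A : Set} {m} (p : A → Bool) (f : Fin m → A) →
  countᵇ p (tabulate f) ≡ sum (λ i → 𝟙 (p (f i)))
countᵇ-tabulate {m = zero}  p f = refl
countᵇ-tabulate {m = suc m} p f with p (f zero)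
... | true  = cong suc (countᵇ-tabulate p (λ i → f (suc i)))
... | false = countᵇ-tabulate p (λ i → f (suc i))

countᵇ-allFin : ∀ {m} (p : Fin m → Bool) → countᵇ p (allFin m) ≡ sum (λ i → 𝟙 (p i))
countᵇ-allFin p = countᵇ-tabulate p (λ i → i)

countᵇ-lookup : ∀ {A : Set} (p : A → Bool) (xs : List A) →
  sum (λ i → 𝟙 (p (lookup xs i))) ≡ countᵇ p xs
countᵇ-lookup p []       = refl
countᵇ-lookup p (x ∷ xs) with p x
... | true  = cong suc (countᵇ-lookup p xs)
... | false = countᵇ-lookup p xs

countᵇ-++ : ∀ {A : Set} (p : A → Bool) (xs ys : List A) →
  countᵇ p (xs ++ ys) ≡ countᵇ p xs + countᵇ p ys
countᵇ-++ p []       ys = refl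
countᵇ-++ p (x ∷ xs) ys with p x
... | true  = cong suc (countᵇ-++ p xs ys)
... | false = countᵇ-++ p xs ys

countᵇ-map : ∀ {A B : Set} (p : B → Bool) (f : A → B) (xs : List A) →
  countᵇ p (map f xs) ≡ countᵇ (λ x → p (f x)) xs
countᵇ-map p f []       = refl
countᵇ-map p f (x ∷ xs) with p (f x)
... | true  = cong suc (countᵇ-map p f xs)
... | false = countᵇ-map p f xs

countᵇ-filterᵇ : ∀ {A : Set} (p q : A → Bool) (xs : List A) →
  countᵇ p (filterᵇ q xs) ≡ countᵇ (λ x → q x ∧ p x) xs
countᵇ-filterᵇ p q []       = refl
countᵇ-filterᵇ p q (x ∷ xs) with q x
... | false = countᵇ-filterᵇ p q xs
... | true with p x
...   | true  = cong suc (countᵇ-filterᵇ p q xs)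
...   | false = countᵇ-filterᵇ p q xs

injection≤count : ∀ {m k} (p : Fin m → Bool) (g : Fin k → Fin m) →
  Injective _≡_ _≡_ g → (∀ i → p (g i) ≡ true) → k ≤ sum (λ e → 𝟙 (p e))
injection≤count {zero}  {zero}  p g inj pg = z≤n
injection≤count {zero}  {suc k} p g inj pg with g zero
... | ()
injection≤count {suc m} {zero}  p g inj pg = z≤n
injection≤count {suc m} {suc k} p g inj pg with any? (λ i → g i ≟ zero)
... | no g≢0 =
  ≤-trans (injection≤count (λ e → p (suc e)) g′ inj′ pg′) (m≤n+m _ (𝟙 (p zero)))
  where
  0≢g : ∀ i → zero ≢ g i
  0≢g i 0≡gi = g≢0 (i , sym 0≡gi)
  g′ : Fin (suc k) → Fin m
  g′ i = punchOut (0≢g i)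
  inj′ : Injective _≡_ _≡_ g′
  inj′ {x} {y} eq = inj (punchOut-injective (0≢g x) (0≢g y) eq)
  pg′ : ∀ i → p (suc (g′ i)) ≡ true
  pg′ i = trans (cong p (punchIn-punchOut (0≢g i))) (pg i)
... | yes (i₀ , gi₀≡0) =
  subst (λ b → suc k ≤ 𝟙 b + sum (λ e → 𝟙 (p (suc e)))) (sym (trans (cong p (sym gi₀≡0)) (pg i₀)))
    (s≤s (injection≤count (λ e → p (suc e)) g′ inj′ pg′))
  where
  0≢g : ∀ j → zero ≢ g (punchIn i₀ j)
  0≢g j 0≡g = punchInᵢ≢i i₀ j (inj (trans (sym 0≡g) (sym gi₀≡0)))
  g′ : Fin k → Fin m
  g′ j = punchOut (0≢g j)
  inj′ : Injective _≡_ _≡_ g′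
  inj′ {x} {y} eq = punchIn-injective i₀ x y (inj (punchOut-injective (0≢g x) (0≢g y) eq))
  pg′ : ∀ j → p (suc (g′ j)) ≡ true
  pg′ j = trans (cong p (punchIn-punchOut (0≢g j))) (pg (punchIn i₀ j))

𝟙≡0⇒false : ∀ {b} → 𝟙 b ≡ 0 → b ≡ false
𝟙≡0⇒false {false} _ = refl

-- Vertex sets, cuts and lifting

true≢false : true ≢ false
true≢false ()

==⇒≡ : ∀ {m} {x y : Fin m} → x == y ≡ true → x ≡ y
==⇒≡ {x = x} {y} x==y with x ≟ y
... | yes x≡y = x≡y

==-refl : ∀ {m} (x : Fin m) → x == x ≡ true
==-refl x with x ≟ x
... | yes _   = refl
... | no x≢x = ⊥-elim (x≢x refl)

≢⇒==-false : ∀ {m} {x y : Fin m} → x ≢ y → x == y ≡ false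
≢⇒==-false {x = x} {y} x≢y with x ≟ y
... | yes x≡y = ⊥-elim (x≢y x≡y)
... | no  _   = refl

∈⇒memb : ∀ {m} {x : Fin m} {p : Subset m} → x ∈ p → memb p x ≡ true
∈⇒memb = []=⇒lookup

memb⇒∈ : ∀ {m} {x : Fin m} {p : Subset m} → memb p x ≡ true → x ∈ p
memb⇒∈ {x = x} {p} = lookup⇒[]= x p

∉⇒memb : ∀ {m} {x : Fin m} {p : Subset m} → x ∉ p → memb p x ≡ false
∉⇒memb {x = x} {p} x∉p with memb p x in eq
... | true  = ⊥-elim (x∉p (memb⇒∈ eq))
... | false = refl

memb-≢ : ∀ {m} (X : Subset m) {x y} → memb X x ≡ true → memb X y ≡ false → x ≢ y
memb-≢ X x∈X y∉X x≡y = true≢false (trans (sym x∈X) (trans (cong (memb X) x≡y) y∉X))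

∧∧not≡true : ∀ {a b c} → (a ∧ b) ∧ not c ≡ true → a ≡ true × b ≡ true × c ≡ false
∧∧not≡true {true} {true} {false} refl = refl , refl , refl

memb-∩ : ∀ {m} (X Y : Subset m) v → memb (X ∩ Y) v ≡ memb X v ∧ memb Y v
memb-∩ X Y v = lookup-zipWith _∧_ v X Y

memb-∪ : ∀ {m} (X Y : Subset m) v → memb (X ∪ Y) v ≡ memb X v ∨ memb Y v
memb-∪ X Y v = lookup-zipWith _∨_ v X Y

memb-∖ : ∀ {m} (X Y : Subset m) v → memb (X ∖ Y) v ≡ memb X v ∧ not (memb Y v)
memb-∖ X Y v = lookup-zipWith (λ a b → a ∧ not b) v X Y

memb-⊥ : ∀ {m} v → memb (Subset.⊥ {m}) v ≡ false
memb-⊥ v = lookup-replicate v false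

memb-⁅⁆ : ∀ {m} (s v : Fin m) → memb ⁅ s ⁆ v ≡ (v == s)
memb-⁅⁆ zero    zero    = refl
memb-⁅⁆ zero    (suc v) = memb-⊥ v
memb-⁅⁆ (suc s) zero    = refl
memb-⁅⁆ (suc s) (suc v) with v ≟ s | memb-⁅⁆ s v
... | yes _ | eq = eq
... | no  _ | eq = eq

∣∣≡sum : ∀ {m} (p : Subset m) → ∣ p ∣ ≡ sum (λ i → 𝟙 (memb p i))
∣∣≡sum []          = refl
∣∣≡sum (true  ∷ p) = cong suc (∣∣≡sum p)
∣∣≡sum (false ∷ p) = ∣∣≡sum p

walk-crosses-cut : ∀ {G : Graph} (X : VSet G) {u v} (p : Walk G u v) →
  memb X u ≡ true → memb X v ≡ false →
  Σ (Edge G) λ e → e ∈ₗ walkEdges p × cutB G X e ≡ true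
walk-crosses-cut X []               u∈X v∉X = ⊥-elim (true≢false (trans (sym u∈X) v∉X))
walk-crosses-cut {G} X {u} (step {w = w} e joins p) u∈X v∉X with memb X w in w∈?X
... | true  = let (e′ , e′∈p , cut) = walk-crosses-cut X p w∈?X v∉X in e′ , there e′∈p , cut
... | false = e , here refl , e-crosses joins
  where
  e-crosses : Joins G e u w → cutB G X e ≡ true
  e-crosses (inj₁ ends≡) rewrite ends≡ | u∈X | w∈?X = refl
  e-crosses (inj₂ ends≡) rewrite ends≡ | u∈X | w∈?X = refl

SKConnected⇒k≤cutSize : ∀ {H : Graph} {s : Vertex H} {k} → SKConnected H s k →
  (X : VSet H) → memb X s ≡ false → ∀ {u w} → memb X u ≡ true → memb X w ≡ false → w ≢ s →
  k ≤ cutSize H X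
SKConnected⇒k≤cutSize {H} {s} {k} (_ , _ , paths) X s∉X {u} {w} u∈X w∉X w≢s =
  subst (k ≤_) (sym (countᵇ-allFin (cutB H X)))
    (injection≤count (cutB H X) crossing crossing-injective (λ i → proj₂ (proj₂ (crossing-in i))))
  where
  uw-paths = paths u w (memb-≢ X u∈X s∉X) w≢s (memb-≢ X u∈X w∉X)
  P = proj₁ uw-paths
  disjoint = proj₂ (proj₂ uw-paths)
  crossing-in : ∀ i → Σ (Edge H) λ e → e ∈ₗ walkEdges (P i) × cutB H X e ≡ true
  crossing-in i = walk-crosses-cut X (P i) u∈X w∉X
  crossing : Fin k → Edge H
  crossing i = proj₁ (crossing-in i)
  crossing-injective : ∀ {i j} → crossing i ≡ crossing j → i ≡ j
  crossing-injective {i} {j} eq with i ≟ j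
  ... | yes i≡j = i≡j
  ... | no  i≢j = ⊥-elim (disjoint i j i≢j (crossing i) (proj₁ (proj₂ (crossing-in i)))
                          (subst (_∈ₗ walkEdges (P j)) (sym eq) (proj₁ (proj₂ (crossing-in j)))))

crosses : ∀ {m} → Subset m → Fin m × Fin m → Bool
crosses X uv = memb X (proj₁ uv) xor memb X (proj₂ uv)

module _ (G : Graph) (s : Vertex G) (e f : Edge G) where

  kept : Edge G → Bool
  kept i = not (i == e) ∧ not (i == f)

  newEdges : List (Vertex G × Vertex G)
  newEdges = if other G s e == other G s f then [] else [ (other G s e , other G s f) ]

  cutSize-lift : (X : VSet G) →
    cutSize (lift G s e f) X ≡ sum (λ i → 𝟙 (kept i ∧ cutB G X i)) + countᵇ (crosses X) newEdges
  cutSize-lift X = begin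
    cutSize (lift G s e f) X
      ≡⟨ countᵇ-allFin (cutB (lift G s e f) X) ⟩
    sum (λ i → 𝟙 (crosses X (lookup (keptEdges ++ newEdges) i)))
      ≡⟨ countᵇ-lookup (crosses X) (keptEdges ++ newEdges) ⟩
    countᵇ (crosses X) (keptEdges ++ newEdges)
      ≡⟨ countᵇ-++ (crosses X) keptEdges newEdges ⟩
    countᵇ (crosses X) keptEdges + countᵇ (crosses X) newEdges
      ≡⟨ cong (_+ countᵇ (crosses X) newEdges) keptCount ⟩
    sum (λ i → 𝟙 (kept i ∧ cutB G X i)) + countᵇ (crosses X) newEdges ∎
    where
    open ≡-Reasoning
    keptEdges = map (lookup (edges G)) (filterᵇ kept (allFin _))
    keptCount : countᵇ (crosses X) keptEdges ≡ sum (λ i → 𝟙 (kept i ∧ cutB G X i))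
    keptCount = trans (countᵇ-map (crosses X) (lookup (edges G)) (filterᵇ kept (allFin _)))
                (trans (countᵇ-filterᵇ (cutB G X) kept (allFin _))
                       (countᵇ-allFin (λ i → kept i ∧ cutB G X i)))

  𝟙-split : ∀ a b → 𝟙 b ≡ 𝟙 (a ∧ b) + 𝟙 (not a ∧ b)
  𝟙-split true  b = sym (+-identityʳ (𝟙 b))
  𝟙-split false b = refl

  cutSize-lift+2≤cutSize : (X : VSet G) → e ≢ f → cutB G X e ≡ true → cutB G X f ≡ true →
    memb X (other G s e) ≡ true → memb X (other G s f) ≡ true →
    cutSize (lift G s e f) X + 2 ≤ cutSize G X
  cutSize-lift+2≤cutSize X e≢f e∈δX f∈δX v∈X w∈X = begin
    cutSize (lift G s e f) X + 2
      ≡⟨ cong (_+ 2) (trans (cutSize-lift X) (trans (cong (remaining +_) no-new-crossing) (+-identityʳ _))) ⟩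
    remaining + 2
      ≤⟨ +-monoʳ-≤ remaining (subst (_≤ sum removed) (cong₂ _+_ removed-e removed-f)
                                    (two-terms≤sum removed e≢f)) ⟩
    remaining + sum removed
      ≡⟨ ∑-distrib-+ (λ i → 𝟙 (kept i ∧ cutB G X i)) removed ⟨
    sum (λ i → 𝟙 (kept i ∧ cutB G X i) + removed i)
      ≡⟨ sum-cong-≗ (λ i → 𝟙-split (kept i) (cutB G X i)) ⟨
    sum (λ i → 𝟙 (cutB G X i))
      ≡⟨ countᵇ-allFin (cutB G X) ⟨
    cutSize G X ∎
    where
    open ≤-Reasoning
    remaining = sum (λ i → 𝟙 (kept i ∧ cutB G X i))
    removed : Edge G → ℕ
    removed i = 𝟙 (not (kept i) ∧ cutB G X i)
    removed-e : removed e ≡ 1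
    removed-e rewrite ==-refl e | e∈δX = refl
    removed-f : removed f ≡ 1
    removed-f rewrite ==-refl f | ≢⇒==-false (λ f≡e → e≢f (sym f≡e)) | f∈δX = refl
    no-new-crossing : countᵇ (crosses X) newEdges ≡ 0
    no-new-crossing with other G s e == other G s f
    ... | true  = refl
    ... | false rewrite v∈X | w∈X = refl

at-s⇒∈cut : (G : Graph) (s : Vertex G) (X : VSet G) (e : Edge G) →
  memb X s ≡ false → At G s e → memb X (other G s e) ≡ true → cutB G X e ≡ true
at-s⇒∈cut G s X e s∉X at v∈X with proj₁ (ends G e) == s in end₁≡s
... | true  rewrite ==⇒≡ end₁≡s | s∉X | v∈X = refl
... | false rewrite ==⇒≡ at | s∉X | v∈X = refl

other≢s : ∀ {G s} → Loopless G → ∀ {e} → At G s e → other G s e ≢ s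
other≢s {G} {s} loopless {e} e-at with proj₁ (ends G e) == s in end₁==s
... | true  = λ end₂≡s → loopless e (trans (==⇒≡ end₁==s) (sym end₂≡s))
... | false = λ end₁≡s → true≢false (trans (sym (==-refl s)) (trans (cong (_== s) (sym end₁≡s)) end₁==s))

betweenB-⁅s⁆ : (G : Graph) (s : Vertex G) (X : VSet G) → memb X s ≡ false →
  ∀ e → betweenB G ⁅ s ⁆ X e ≡ atB G s e ∧ memb X (other G s e)
betweenB-⁅s⁆ G s X s∉X e
  rewrite memb-⁅⁆ s (proj₁ (ends G e)) | memb-⁅⁆ s (proj₂ (ends G e))
  with proj₁ (ends G e) == s in end₁==s
... | false = refl
... | true rewrite ==⇒≡ end₁==s | s∉X with memb X (proj₂ (ends G e))
...   | true  = refl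
...   | false = ∧-zeroʳ _

record Dangerousᵇ (G : Graph) (s : Vertex G) (k : ℕ) (A : VSet G) : Set where
  field
    s∉ : memb A s ≡ false
    outsider : Vertex G
    outsider∉ : memb A outsider ≡ false
    outsider≢s : outsider ≢ s
    cut≤ : cutSize G A ≤ suc k

toDangerousᵇ : ∀ {G s k A} → Dangerous G s k A → Dangerousᵇ G s k A
toDangerousᵇ (s∉A , _ , (w , w≢s , w∉A) , cut≤) = record
  { s∉ = ∉⇒memb s∉A ; outsider = w ; outsider∉ = ∉⇒memb w∉A ; outsider≢s = w≢s ; cut≤ = cut≤ }

liftable⇒k+2≤cutSize : ∀ {G s k} {e f : Edge G} → Liftable G s k e f → e ≢ f → At G s e → At G s f →
  (X : VSet G) → memb X s ≡ false → memb X (other G s e) ≡ true → memb X (other G s f) ≡ true →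
  ∀ {w} → memb X w ≡ false → w ≢ s → k + 2 ≤ cutSize G X
liftable⇒k+2≤cutSize {G} {s} {k} {e} {f} liftable e≢f e-at f-at X s∉X v∈X w∈X w∉X w≢s = begin
  k + 2                         ≤⟨ +-monoˡ-≤ 2 (SKConnected⇒k≤cutSize liftable X s∉X v∈X w∉X w≢s) ⟩
  cutSize (lift G s e f) X + 2  ≤⟨ cutSize-lift+2≤cutSize G s e f X e≢f (at-s⇒∈cut G s X e s∉X e-at v∈X)
                                                                 (at-s⇒∈cut G s X f s∉X f-at w∈X) v∈X w∈X ⟩
  cutSize G X                   ∎
  where open ≤-Reasoning

dangerous⇒¬liftable : ∀ {G s k A} → Dangerousᵇ G s k A → ∀ {e f} → e ≢ f → At G s e → At G s f →
  memb A (other G s e) ≡ true → memb A (other G s f) ≡ true → ¬ Liftable G s k e f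
dangerous⇒¬liftable {G} {k = k} {A} D e≢f e-at f-at v∈A w∈A liftable = 1+n≰n (begin
  2 + k         ≡⟨ +-comm 2 k ⟩
  k + 2         ≤⟨ liftable⇒k+2≤cutSize {G} liftable e≢f e-at f-at A s∉ v∈A w∈A outsider∉ outsider≢s ⟩
  cutSize G A   ≤⟨ cut≤ ⟩
  suc k         ∎)
  where
  open Dangerousᵇ D
  open ≤-Reasoning

module _ {G : Graph} {s : Vertex G} {k : ℕ} where

  maxIndependent-absorbs : ∀ {I} → MaxIndependent G s k I → ∀ {f} → At G s f →
    (∀ g → g ∈ I → ¬ LAdj G s k f g × ¬ LAdj G s k g f) → f ∈ I
  maxIndependent-absorbs {I} ((at-s , independent) , maximal) {f} f-at f-nonadjacent =
    maximal (I ∪ ⁅ f ⁆) (at-s′ , independent′) (p⊆p∪q ⁅ f ⁆) (q⊆p∪q I ⁅ f ⁆ (x∈⁅x⁆ f))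
    where
    at-s′ : LVertexSet G s (I ∪ ⁅ f ⁆)
    at-s′ e e∈ with x∈p∪q⁻ I ⁅ f ⁆ e∈
    ... | inj₁ e∈I = at-s e e∈I
    ... | inj₂ e∈f rewrite x∈⁅y⁆⇒x≡y f e∈f = f-at
    independent′ : ∀ e g → e ∈ I ∪ ⁅ f ⁆ → g ∈ I ∪ ⁅ f ⁆ → ¬ LAdj G s k e g
    independent′ e g e∈ g∈ with x∈p∪q⁻ I ⁅ f ⁆ e∈ | x∈p∪q⁻ I ⁅ f ⁆ g∈
    ... | inj₁ e∈I | inj₁ g∈I = independent e g e∈I g∈I
    ... | inj₁ e∈I | inj₂ g∈f rewrite x∈⁅y⁆⇒x≡y f g∈f = proj₂ (f-nonadjacent e e∈I)
    ... | inj₂ e∈f | inj₁ g∈I rewrite x∈⁅y⁆⇒x≡y f e∈f = proj₁ (f-nonadjacent g g∈I)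
    ... | inj₂ e∈f | inj₂ g∈f rewrite x∈⁅y⁆⇒x≡y f e∈f | x∈⁅y⁆⇒x≡y f g∈f = λ adj → proj₁ adj refl

  -- The s-edges ending in a dangerous set form an independent set of L(G,s,k).
  edges-into-dangerous-∈maxIndependent : ∀ {I A} → MaxIndependent G s k I → Dangerousᵇ G s k A →
    ContainsOtherEnds G s I A → ∀ {e} → At G s e → memb A (other G s e) ≡ true → e ∈ I
  edges-into-dangerous-∈maxIndependent {I} {A} ((at-s , _) , maximal) D I→A {e} e-at v∈A =
    maximal into-A (into-A-at-s , into-A-independent) I⊆into-A (memb⇒∈ (into-A-memb e-at v∈A))
    where
    intoA? : Edge G → Bool
    intoA? e = atB G s e ∧ memb A (other G s e)
    into-A : ESet G
    into-A = Vec.tabulate intoA?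
    into-A-memb : ∀ {e} → At G s e → memb A (other G s e) ≡ true → memb into-A e ≡ true
    into-A-memb {e} e-at v∈A rewrite lookup∘tabulate intoA? e | e-at | v∈A = refl
    into-A⇒ : ∀ {e} → e ∈ into-A → At G s e × memb A (other G s e) ≡ true
    into-A⇒ {e} e∈ with atB G s e | memb A (other G s e) | trans (sym (lookup∘tabulate intoA? e)) (∈⇒memb e∈)
    ... | true | true | _ = refl , refl
    into-A-at-s : LVertexSet G s into-A
    into-A-at-s e e∈ = proj₁ (into-A⇒ e∈)
    into-A-independent : ∀ e f → e ∈ into-A → f ∈ into-A → ¬ LAdj G s k e f
    into-A-independent e f e∈ f∈ (e≢f , e-at , f-at , liftable) =
      dangerous⇒¬liftable D e≢f e-at f-at (proj₂ (into-A⇒ e∈)) (proj₂ (into-A⇒ f∈)) liftable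
    I⊆into-A : I ⊆ into-A
    I⊆into-A {e} e∈I = memb⇒∈ (into-A-memb (at-s e e∈I) (∈⇒memb (I→A e e∈I)))

  ∉maxIndependent⇒other∉ : ∀ {I A} → MaxIndependent G s k I → Dangerousᵇ G s k A →
    ContainsOtherEnds G s I A → ∀ {e} → e ∉ I → At G s e → memb A (other G s e) ≡ false
  ∉maxIndependent⇒other∉ {I} {A} mI D I→A {e} e∉I e-at with memb A (other G s e) in v∈A
  ... | true  = ⊥-elim (e∉I (edges-into-dangerous-∈maxIndependent mI D I→A e-at v∈A))
  ... | false = refl

  maxIndependent-≢⇒∃∖ : ∀ {I J} → Independent G s k I → MaxIndependent G s k J → I ≢ J →
    ∃ λ e → e ∈ J × e ∉ I
  maxIndependent-≢⇒∃∖ {I} {J} iI (_ , J-maximal) I≢J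
    with ¬∀⟶∃¬ _ (λ e → e ∈ J → e ∈ I) (λ e → dec e) J⊈I
    where
    dec : ∀ e → Dec (e ∈ J → e ∈ I)
    dec e with e ∈? J | e ∈? I
    ... | yes _   | yes e∈I = yes (λ _ → e∈I)
    ... | yes e∈J | no  e∉I = no (λ J⇒I → e∉I (J⇒I e∈J))
    ... | no  e∉J | _       = yes (λ e∈J → ⊥-elim (e∉J e∈J))
    J⊈I : ¬ (∀ e → e ∈ J → e ∈ I)
    J⊈I J⊆I = I≢J (⊆-antisym (J-maximal I iI (λ {e} → J⊆I e)) (λ {e} → J⊆I e))
  ... | (e , ¬J⇒I) with e ∈? J | e ∈? I
  ... | yes e∈J | no  e∉I = e , e∈J , e∉I
  ... | yes _   | yes e∈I = ⊥-elim (¬J⇒I (λ _ → e∈I))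
  ... | no  e∉J | _       = ⊥-elim (¬J⇒I (λ e∈J → ⊥-elim (e∉J e∈J)))

  ∣maxIndependent∣≡betweenSize : ∀ {I A} → MaxIndependent G s k I → Dangerousᵇ G s k A →
    ContainsOtherEnds G s I A → ∣ I ∣ ≡ betweenSize G ⁅ s ⁆ A
  ∣maxIndependent∣≡betweenSize {I} {A} mI D I→A = begin
    ∣ I ∣                                   ≡⟨ ∣∣≡sum I ⟩
    sum (λ e → 𝟙 (memb I e))               ≡⟨ sum-cong-≗ (λ e → cong 𝟙 (I≡edges-into-A e)) ⟩
    sum (λ e → 𝟙 (betweenB G ⁅ s ⁆ A e))   ≡⟨ countᵇ-allFin (betweenB G ⁅ s ⁆ A) ⟨
    betweenSize G ⁅ s ⁆ A                   ∎
    where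
    open ≡-Reasoning
    I≡edges-into-A : ∀ e → memb I e ≡ betweenB G ⁅ s ⁆ A e
    I≡edges-into-A e rewrite betweenB-⁅s⁆ G s A (Dangerousᵇ.s∉ D) e
      with memb I e in e∈?I
    ... | true rewrite proj₁ (proj₁ mI) e (memb⇒∈ e∈?I) | ∈⇒memb (I→A e (memb⇒∈ e∈?I)) = refl
    ... | false with atB G s e in e-at | memb A (other G s e) in v∈?A
    ...   | false | _     = refl
    ...   | true  | false = refl
    ...   | true  | true  = ⊥-elim (true≢false (trans
            (sym (∈⇒memb (edges-into-dangerous-∈maxIndependent mI D I→A e-at v∈?A))) e∈?I))

-- Counting edges by the cells of their ends

-- A cell records whether a vertex is s and which of the sets A₀, …, Aₙ₋₁ contain it; an edge
-- type is the pair of cells of the ends of an edge.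
Cell : ℕ → Set
Cell n = Bool × Vec Bool n

Region : ℕ → Set
Region n = Cell n → Bool

atS : ∀ {n} → Region n
atS = proj₁

inside : ∀ {n} → Fin n → Region n
inside i c = Vec.lookup (proj₂ c) i

infixl 7 _∩ʳ_
infixl 6 _∪ʳ_ _∖ʳ_

_∩ʳ_ _∪ʳ_ _∖ʳ_ : ∀ {n} → Region n → Region n → Region n
(φ ∩ʳ ψ) c = φ c ∧ ψ c
(φ ∪ʳ ψ) c = φ c ∨ ψ c
(φ ∖ʳ ψ) c = φ c ∧ not (ψ c)

∁ʳ : ∀ {n} → Region n → Region n
∁ʳ φ c = not (φ c)

EdgeType : ℕ → Set
EdgeType n = Cell n × Cell n

cutᵗ : ∀ {n} → Region n → EdgeType n → Bool
cutᵗ φ t = φ (proj₁ t) xor φ (proj₂ t)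

betweenᵗ : ∀ {n} → Region n → Region n → EdgeType n → Bool
betweenᵗ φ ψ t = (φ (proj₁ t) ∧ ψ (proj₂ t)) ∨ (φ (proj₂ t) ∧ ψ (proj₁ t))

Weight : ℕ → Set
Weight n = EdgeType n → ℕ

cutʷ : ∀ {n} → Region n → Weight n
cutʷ φ t = 𝟙 (cutᵗ φ t)

betweenʷ : ∀ {n} → Region n → Region n → Weight n
betweenʷ φ ψ t = 𝟙 (betweenᵗ φ ψ t)

Σʷ : ∀ {n} → List (Weight n) → Weight n
Σʷ []       t = 0
Σʷ (w ∷ ws) t = w t + Σʷ ws t

noneᵇ : ∀ {n} → Vec Bool n → Bool
noneᵇ []       = true
noneᵇ (b ∷ bs) = not b ∧ noneᵇ bs

-- The edge types that can occur in a loopless graph in which s lies in none of the sets,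
-- when every vertex lies in the region κ.
possible : ∀ {n} → Region n → EdgeType n → Bool
possible κ t = admissible (proj₁ t) ∧ admissible (proj₂ t) ∧ not (atS (proj₁ t) ∧ atS (proj₂ t))
  where admissible = λ c → (not (atS c) ∨ noneᵇ (proj₂ c)) ∧ κ c

allᵇ : (Bool → Bool) → Bool
allᵇ p = p true ∧ p false

allVec : ∀ n → (Vec Bool n → Bool) → Bool
allVec zero    p = p []
allVec (suc n) p = allᵇ (λ b → allVec n (λ bs → p (b ∷ bs)))

allCells : ∀ {n} → (Cell n → Bool) → Bool
allCells {n} p = allᵇ λ a → allVec n λ as → p (a , as)

allTypes : ∀ {n} → (EdgeType n → Bool) → Bool
allTypes p = allCells λ x → allCells λ y → p (x , y)

allᵇ-sound : ∀ p → T (allᵇ p) → ∀ b → T (p b)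
allᵇ-sound p all-p true  = proj₁ (Equivalence.to T-∧ all-p)
allᵇ-sound p all-p false = proj₂ (Equivalence.to T-∧ all-p)

allVec-sound : ∀ n p → T (allVec n p) → ∀ bs → T (p bs)
allVec-sound zero    p all-p []       = all-p
allVec-sound (suc n) p all-p (b ∷ bs) =
  allVec-sound n (λ bs → p (b ∷ bs)) (allᵇ-sound (λ b → allVec n (λ bs → p (b ∷ bs))) all-p b) bs

allCells-sound : ∀ {n} p → T (allCells {n} p) → ∀ c → T (p c)
allCells-sound {n} p all-p (a , as) =
  allVec-sound n (λ as → p (a , as)) (allᵇ-sound (λ a → allVec n λ as → p (a , as)) all-p a) as

allTypes-sound : ∀ {n} p → T (allTypes {n} p) → ∀ t → T (p t)
allTypes-sound p all-p (x , y) =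
  allCells-sound (λ y → p (x , y)) (allCells-sound (λ x → allCells λ y → p (x , y)) all-p x) y

holdsOn : ∀ {n} → Region n → (EdgeType n → Bool) → (EdgeType n → Bool) → Bool
holdsOn κ ε p = allTypes λ t → not (possible κ t ∧ ε t) ∨ p t

_≤ʷ_under_ : ∀ {n} → List (Weight n) → List (Weight n) → Region n → Bool
ws ≤ʷ ws′ under κ = holdsOn κ (λ _ → true) λ t → Σʷ ws t ≤ᵇ Σʷ ws′ t

_≡ʷ_under_ : ∀ {n} → List (Weight n) → List (Weight n) → Region n → Bool
ws ≡ʷ ws′ under κ = holdsOn κ (λ _ → true) λ t → Σʷ ws t ≡ᵇ Σʷ ws′ t

module Frame (G : Graph) (s : Vertex G) (loopless : Loopless G)
  {n} (As : Vec (VSet G) n) (s∉As : All (λ A → memb A s ≡ false) As) where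

  cellOf : Vertex G → Cell n
  cellOf v = v == s , Vec.map (λ A → memb A v) As

  typeOf : Edge G → EdgeType n
  typeOf e = cellOf (proj₁ (ends G e)) , cellOf (proj₂ (ends G e))

  sCell : Cell n
  sCell = true , Vec.replicate n false

  cellOf-s : cellOf s ≡ sCell
  cellOf-s = cong₂ _,_ (==-refl s) (map-at-s s∉As)
    where
    map-at-s : ∀ {m} {Bs : Vec (VSet G) m} → All (λ A → memb A s ≡ false) Bs →
      Vec.map (λ A → memb A s) Bs ≡ Vec.replicate m false
    map-at-s []             = refl
    map-at-s (s∉B ∷ s∉Bs) = cong₂ _∷_ s∉B (map-at-s s∉Bs)

  possible-typeOf : ∀ κ → (∀ v → T (κ (cellOf v))) → ∀ e → T (possible κ (typeOf e))
  possible-typeOf κ κ-holds e =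
    Equivalence.from T-∧ (admissible end₁ , Equivalence.from T-∧ (admissible end₂ , not-both-s))
    where
    end₁ = proj₁ (ends G e)
    end₂ = proj₂ (ends G e)
    none-replicate : ∀ m → T (noneᵇ (Vec.replicate m false))
    none-replicate zero    = tt
    none-replicate (suc m) = none-replicate m
    s-in-no-set : ∀ v → T (not (atS (cellOf v)) ∨ noneᵇ (proj₂ (cellOf v)))
    s-in-no-set v with v == s in v==s
    ... | false = tt
    ... | true rewrite ==⇒≡ v==s = subst (λ c → T (noneᵇ (proj₂ c))) (sym cellOf-s) (none-replicate n)
    admissible : ∀ v → T ((not (atS (cellOf v)) ∨ noneᵇ (proj₂ (cellOf v))) ∧ κ (cellOf v))
    admissible v = Equivalence.from T-∧ (s-in-no-set v , κ-holds v)
    not-both-s : T (not ((end₁ == s) ∧ (end₂ == s)))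
    not-both-s with end₁ == s in end₁==s | end₂ == s in end₂==s
    ... | false | _     = tt
    ... | true  | false = tt
    ... | true  | true  = loopless e (trans (==⇒≡ end₁==s) (sym (==⇒≡ end₂==s)))

  holdsOn-sound : ∀ κ → (∀ v → T (κ (cellOf v))) → ∀ ε → (∀ e → T (ε (typeOf e))) →
    ∀ p → T (holdsOn κ ε p) → ∀ e → T (p (typeOf e))
  holdsOn-sound κ κ-holds ε ε-holds p check e =
    ⇒ᵇ-sound (allTypes-sound (λ t → not (possible κ t ∧ ε t) ∨ p t) check (typeOf e))
             (Equivalence.from T-∧ (possible-typeOf κ κ-holds e , ε-holds e))
    where
    ⇒ᵇ-sound : ∀ {a b} → T (not a ∨ b) → T a → T b
    ⇒ᵇ-sound {true} b a = b

  count : Weight n → ℕ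
  count w = sum (λ e → w (typeOf e))

  -- Written without a trailing "+ 0", so that Σcount [ w ] is count w.
  Σcount : List (Weight n) → ℕ
  Σcount []                 = 0
  Σcount (w ∷ [])           = count w
  Σcount (w ∷ ws@(_ ∷ _)) = count w + Σcount ws

  count-Σʷ : ∀ ws → count (Σʷ ws) ≡ Σcount ws
  count-Σʷ []                 = sum-replicate-zero (length (edges G))
  count-Σʷ (w ∷ [])           = sum-cong-≗ (λ e → +-identityʳ (w (typeOf e)))
  count-Σʷ (w ∷ ws@(_ ∷ _)) =
    trans (∑-distrib-+ (λ e → w (typeOf e)) (λ e → Σʷ ws (typeOf e))) (cong (count w +_) (count-Σʷ ws))

  Σcount-≤ : ∀ κ → (∀ v → T (κ (cellOf v))) → ∀ ws ws′ → T (ws ≤ʷ ws′ under κ) →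
    Σcount ws ≤ Σcount ws′
  Σcount-≤ κ κ-holds ws ws′ check = subst₂ _≤_ (count-Σʷ ws) (count-Σʷ ws′) (sum-mono-≤ λ e →
    ≤ᵇ⇒≤ _ _ (holdsOn-sound κ κ-holds (λ _ → true) (λ _ → tt) (λ t → Σʷ ws t ≤ᵇ Σʷ ws′ t) check e))

  Σcount-≡ : ∀ κ → (∀ v → T (κ (cellOf v))) → ∀ ws ws′ → T (ws ≡ʷ ws′ under κ) →
    Σcount ws ≡ Σcount ws′
  Σcount-≡ κ κ-holds ws ws′ check = trans (sym (count-Σʷ ws)) (trans (sum-cong-≗ λ e →
    ≡ᵇ⇒≡ _ _ (holdsOn-sound κ κ-holds (λ _ → true) (λ _ → tt) (λ t → Σʷ ws t ≡ᵇ Σʷ ws′ t) check e))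
    (count-Σʷ ws′))

  Σcount-≤₀ : ∀ ws ws′ → T (ws ≤ʷ ws′ under (λ _ → true)) → Σcount ws ≤ Σcount ws′
  Σcount-≤₀ = Σcount-≤ (λ _ → true) (λ _ → tt)

  Σcount-≡₀ : ∀ ws ws′ → T (ws ≡ʷ ws′ under (λ _ → true)) → Σcount ws ≡ Σcount ws′
  Σcount-≡₀ = Σcount-≡ (λ _ → true) (λ _ → tt)

  ∁-holds : ∀ φ → (∀ v → φ (cellOf v) ≡ false) → ∀ v → T (∁ʳ φ (cellOf v))
  ∁-holds φ φ-empty v = Equivalence.from T-not-≡ (φ-empty v)

  ∩-holds : ∀ φ ψ → (∀ v → T (φ (cellOf v))) → (∀ v → T (ψ (cellOf v))) →
    ∀ v → T ((φ ∩ʳ ψ) (cellOf v))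
  ∩-holds φ ψ φ-holds ψ-holds v = Equivalence.from T-∧ (φ-holds v , ψ-holds v)

  record Represents (X : VSet G) (φ : Region n) : Set where
    constructor represents
    field memb≡ : ∀ v → memb X v ≡ φ (cellOf v)
  open Represents public

  represents-inside : ∀ i → Represents (Vec.lookup As i) (inside i)
  represents-inside i = represents λ v → sym (lookup-map i (λ A → memb A v) As)

  represents-⁅s⁆ : Represents ⁅ s ⁆ atS
  represents-⁅s⁆ = represents (memb-⁅⁆ s)

  represents-∩ : ∀ {X Y φ ψ} → Represents X φ → Represents Y ψ → Represents (X ∩ Y) (φ ∩ʳ ψ)
  represents-∩ {X} {Y} X≈φ Y≈ψ =
    represents λ v → trans (memb-∩ X Y v) (cong₂ _∧_ (memb≡ X≈φ v) (memb≡ Y≈ψ v))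

  represents-∪ : ∀ {X Y φ ψ} → Represents X φ → Represents Y ψ → Represents (X ∪ Y) (φ ∪ʳ ψ)
  represents-∪ {X} {Y} X≈φ Y≈ψ =
    represents λ v → trans (memb-∪ X Y v) (cong₂ _∨_ (memb≡ X≈φ v) (memb≡ Y≈ψ v))

  represents-∖ : ∀ {X Y φ ψ} → Represents X φ → Represents Y ψ → Represents (X ∖ Y) (φ ∖ʳ ψ)
  represents-∖ {X} {Y} X≈φ Y≈ψ =
    represents λ v → trans (memb-∖ X Y v) (cong₂ (λ a b → a ∧ not b) (memb≡ X≈φ v) (memb≡ Y≈ψ v))

  regionSet : Region n → VSet G
  regionSet φ = Vec.tabulate (λ v → φ (cellOf v))

  represents-regionSet : ∀ φ → Represents (regionSet φ) φ
  represents-regionSet φ = represents (lookup∘tabulate (λ v → φ (cellOf v)))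

  cutB≡cutᵗ : ∀ {X φ} → Represents X φ → ∀ e → cutB G X e ≡ cutᵗ φ (typeOf e)
  cutB≡cutᵗ X≈φ e = cong₂ _xor_ (memb≡ X≈φ (proj₁ (ends G e))) (memb≡ X≈φ (proj₂ (ends G e)))

  betweenB≡betweenᵗ : ∀ {X Y φ ψ} → Represents X φ → Represents Y ψ →
    ∀ e → betweenB G X Y e ≡ betweenᵗ φ ψ (typeOf e)
  betweenB≡betweenᵗ X≈φ Y≈ψ e =
    cong₂ _∨_ (cong₂ _∧_ (memb≡ X≈φ (proj₁ (ends G e))) (memb≡ Y≈ψ (proj₂ (ends G e))))
              (cong₂ _∧_ (memb≡ X≈φ (proj₂ (ends G e))) (memb≡ Y≈ψ (proj₁ (ends G e))))

  cutSize≡count : ∀ {X φ} → Represents X φ → cutSize G X ≡ count (cutʷ φ)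
  cutSize≡count {X} X≈φ =
    trans (countᵇ-allFin (cutB G X)) (sum-cong-≗ (λ e → cong 𝟙 (cutB≡cutᵗ X≈φ e)))

  betweenSize≡count : ∀ {X Y φ ψ} → Represents X φ → Represents Y ψ →
    betweenSize G X Y ≡ count (betweenʷ φ ψ)
  betweenSize≡count {X} {Y} X≈φ Y≈ψ =
    trans (countᵇ-allFin (betweenB G X Y)) (sum-cong-≗ (λ e → cong 𝟙 (betweenB≡betweenᵗ X≈φ Y≈ψ e)))

  s∉regionSet : ∀ φ → φ sCell ≡ false → memb (regionSet φ) s ≡ false
  s∉regionSet φ φ∌s = trans (memb≡ (represents-regionSet φ) s) (trans (cong φ cellOf-s) φ∌s)

  k≤count-cutʷ : ∀ {k} → SKConnected G s k → ∀ φ → φ sCell ≡ false →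
    ∀ {u w} → φ (cellOf u) ≡ true → φ (cellOf w) ≡ false → w ≢ s → k ≤ count (cutʷ φ)
  k≤count-cutʷ connected φ φ∌s u∈φ w∉φ w≢s =
    subst (_ ≤_) (cutSize≡count (represents-regionSet φ))
      (SKConnected⇒k≤cutSize connected (regionSet φ) (s∉regionSet φ φ∌s)
        (trans (memb≡ (represents-regionSet φ) _) u∈φ) (trans (memb≡ (represents-regionSet φ) _) w∉φ) w≢s)

  betweenʷ-atS : ∀ φ → φ sCell ≡ false → ∀ e →
    betweenʷ atS φ (typeOf e) ≡ 𝟙 (atB G s e ∧ φ (cellOf (other G s e)))
  betweenʷ-atS φ φ∌s e = cong 𝟙 (begin
    betweenᵗ atS φ (typeOf e)
      ≡⟨ betweenB≡betweenᵗ represents-⁅s⁆ (represents-regionSet φ) e ⟨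
    betweenB G ⁅ s ⁆ (regionSet φ) e
      ≡⟨ betweenB-⁅s⁆ G s (regionSet φ) (s∉regionSet φ φ∌s) e ⟩
    atB G s e ∧ memb (regionSet φ) (other G s e)
      ≡⟨ cong (atB G s e ∧_) (memb≡ (represents-regionSet φ) _) ⟩
    atB G s e ∧ φ (cellOf (other G s e)) ∎)
    where open ≡-Reasoning

  betweenʷ-atS≡1 : ∀ φ → φ sCell ≡ false → ∀ {e} → At G s e → φ (cellOf (other G s e)) ≡ true →
    betweenʷ atS φ (typeOf e) ≡ 1
  betweenʷ-atS≡1 φ φ∌s {e} e-at v∈φ rewrite betweenʷ-atS φ φ∌s e | e-at | v∈φ = refl

  occupied? : (φ : Region n) → Σ (Vertex G) (λ v → φ (cellOf v) ≡ true) ⊎ (∀ v → φ (cellOf v) ≡ false)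
  occupied? φ with any? (λ v → φ (cellOf v) Bool.≟ true)
  ... | yes occupied = inj₁ occupied
  ... | no  empty    = inj₂ λ v → ¬-not {φ (cellOf v)} {true} (λ φv≡true → empty (v , φv≡true))

  cut<k⇒empty : ∀ {k} → SKConnected G s k → ∀ φ → φ sCell ≡ false → count (cutʷ φ) < k →
    ∀ {w} → φ (cellOf w) ≡ false → w ≢ s → ∀ v → φ (cellOf v) ≡ false
  cut<k⇒empty connected φ φ∌s cut<k w∉φ w≢s v with φ (cellOf v) in v∈?φ
  ... | false = refl
  ... | true  = ⊥-elim (<⇒≱ cut<k (k≤count-cutʷ connected φ φ∌s v∈?φ w∉φ w≢s))

  typeOf-agree : ∀ κ → (∀ v → T (κ (cellOf v))) → ∀ ε → (∀ e → T (ε (typeOf e))) →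
    (p q : EdgeType n → Bool) → T (holdsOn κ ε (λ t → not (p t xor q t))) →
    ∀ e → p (typeOf e) ≡ q (typeOf e)
  typeOf-agree κ κ-holds ε ε-holds p q check e =
    xnor-sound {p (typeOf e)} (holdsOn-sound κ κ-holds ε ε-holds (λ t → not (p t xor q t)) check e)
    where
    xnor-sound : ∀ {a b} → T (not (a xor b)) → a ≡ b
    xnor-sound {true}  {true}  _ = refl
    xnor-sound {false} {false} _ = refl

-- Two consecutive maximal independent sets

+-≤-tight : ∀ {m m′ n n′} → m′ ≤ m → n′ ≤ n → m + n ≤ m′ + n′ → m ≡ m′ × n ≡ n′
+-≤-tight {m} {m′} {n} {n′} m′≤m n′≤n m+n≤ =
  ≤-antisym (+-cancelʳ-≤ n m m′ (≤-trans m+n≤ (+-monoʳ-≤ m′ n′≤n))) m′≤m ,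
  ≤-antisym (+-cancelˡ-≤ m n n′ (≤-trans m+n≤ (+-monoˡ-≤ n′ m′≤m))) n′≤n

record EdgeAt (G : Graph) (s : Vertex G) (A B : VSet G) (inA? inB? : Bool) : Set where
  field
    edge : Edge G
    at : At G s edge
    A? : memb A (other G s edge) ≡ inA?
    B? : memb B (other G s edge) ≡ inB?

module Pair {G : Graph} {s : Vertex G} {k : ℕ} (loopless : Loopless G) (connected : SKConnected G s k)
  {I J : ESet G} (mI : MaxIndependent G s k I) (mJ : MaxIndependent G s k J) (I≢J : I ≢ J)
  {e : Edge G} (e∈I : e ∈ I) (e∈J : e ∈ J)
  {A B : VSet G} (DA : Dangerousᵇ G s k A) (DB : Dangerousᵇ G s k B)
  (I→A : ContainsOtherEnds G s I A) (J→B : ContainsOtherEnds G s J B) where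

  open Frame G s loopless (A ∷ B ∷ []) (Dangerousᵇ.s∉ DA ∷ Dangerousᵇ.s∉ DB ∷ [])

  e-at : At G s e
  e-at = proj₁ (proj₁ mI) e e∈I

  common : Vertex G
  common = other G s e

  common∈A : memb A common ≡ true
  common∈A = ∈⇒memb (I→A e e∈I)

  common∈B : memb B common ≡ true
  common∈B = ∈⇒memb (J→B e e∈J)

  common≢s : common ≢ s
  common≢s = other≢s {G} loopless e-at

  I∖J-edge : EdgeAt G s A B true false
  I∖J-edge with maxIndependent-≢⇒∃∖ {G} {s} {k} (proj₁ mJ) mI (λ J≡I → I≢J (sym J≡I))
  ... | g , g∈I , g∉J = record
    { edge = g ; at = g-at ; A? = ∈⇒memb (I→A g g∈I)
    ; B? = ∉maxIndependent⇒other∉ mJ DB J→B g∉J g-at }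
    where g-at = proj₁ (proj₁ mI) g g∈I

  J∖I-edge : EdgeAt G s A B false true
  J∖I-edge with maxIndependent-≢⇒∃∖ {G} {s} {k} (proj₁ mI) mJ I≢J
  ... | g , g∈J , g∉I = record
    { edge = g ; at = g-at ; A? = ∉maxIndependent⇒other∉ mI DA I→A g∉I g-at
    ; B? = ∈⇒memb (J→B g g∈J) }
    where g-at = proj₁ (proj₁ mJ) g g∈J

  inA inB : Region 2
  inA = inside zero
  inB = inside (suc zero)

  represents-A : Represents A inA
  represents-A = represents-inside zero

  represents-B : Represents B inB
  represents-B = represents-inside (suc zero)

  outside : Region 2
  outside = ∁ʳ (atS ∪ʳ inA ∪ʳ inB)

  count-A≤ : count (cutʷ inA) ≤ suc k
  count-A≤ = subst (_≤ suc k) (cutSize≡count represents-A) (Dangerousᵇ.cut≤ DA)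

  count-B≤ : count (cutʷ inB) ≤ suc k
  count-B≤ = subst (_≤ suc k) (cutSize≡count represents-B) (Dangerousᵇ.cut≤ DB)

  k≤count-A∖B : k ≤ count (cutʷ (inA ∖ʳ inB))
  k≤count-A∖B = k≤count-cutʷ connected (inA ∖ʳ inB) refl
    (cong₂ (λ a b → a ∧ not b) (EdgeAt.A? I∖J-edge) (EdgeAt.B? I∖J-edge))
    (cong₂ (λ a b → a ∧ not b) common∈A common∈B) common≢s

  k≤count-B∖A : k ≤ count (cutʷ (inB ∖ʳ inA))
  k≤count-B∖A = k≤count-cutʷ connected (inB ∖ʳ inA) refl
    (cong₂ (λ a b → a ∧ not b) (EdgeAt.B? J∖I-edge) (EdgeAt.A? J∖I-edge))
    (cong₂ (λ a b → a ∧ not b) common∈B common∈A) common≢s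

  1≤count-s-A∩B : 1 ≤ count (betweenʷ atS (inA ∩ʳ inB))
  1≤count-s-A∩B = subst (_≤ count (betweenʷ atS (inA ∩ʳ inB)))
    (betweenʷ-atS≡1 (inA ∩ʳ inB) refl e-at (cong₂ _∧_ common∈A common∈B)) (term≤sum _ e)

  cut-A+cut-B : count (cutʷ inA) + count (cutʷ inB)
    ≡ count (cutʷ (inA ∖ʳ inB)) + (count (cutʷ (inB ∖ʳ inA))
        + (count (betweenʷ (inA ∩ʳ inB) (∁ʳ (inA ∪ʳ inB))) + count (betweenʷ (inA ∩ʳ inB) (∁ʳ (inA ∪ʳ inB)))))
  cut-A+cut-B = Σcount-≡₀ (cutʷ inA ∷ cutʷ inB ∷ [])
    (cutʷ (inA ∖ʳ inB) ∷ cutʷ (inB ∖ʳ inA) ∷ betweenʷ (inA ∩ʳ inB) (∁ʳ (inA ∪ʳ inB))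
      ∷ betweenʷ (inA ∩ʳ inB) (∁ʳ (inA ∪ʳ inB)) ∷ []) tt

  between-A∩B-out : count (betweenʷ (inA ∩ʳ inB) (∁ʳ (inA ∪ʳ inB)))
    ≡ count (betweenʷ atS (inA ∩ʳ inB)) + count (betweenʷ (inA ∩ʳ inB) outside)
  between-A∩B-out = Σcount-≡₀ (betweenʷ (inA ∩ʳ inB) (∁ʳ (inA ∪ʳ inB)) ∷ [])
    (betweenʷ atS (inA ∩ʳ inB) ∷ betweenʷ (inA ∩ʳ inB) outside ∷ []) tt

  record Tight : Set where
    field
      count-A : count (cutʷ inA) ≡ suc k
      count-B : count (cutʷ inB) ≡ suc k
      count-A∖B : count (cutʷ (inA ∖ʳ inB)) ≡ k
      count-B∖A : count (cutʷ (inB ∖ʳ inA)) ≡ k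
      count-s-A∩B : count (betweenʷ atS (inA ∩ʳ inB)) ≡ 1
      count-A∩B-outside : count (betweenʷ (inA ∩ʳ inB) outside) ≡ 0

  -- Both dangerous cuts have size at most k + 1, while δ(A ∖ B), δ(B ∖ A) have size at
  -- least k and A ∩ B sends an edge to s, so every inequality in cut-A+cut-B is tight.
  tight : Tight
  tight = record
    { count-A = sym (proj₁ A,B) ; count-B = sym (proj₂ A,B)
    ; count-A∖B = proj₁ A∖B,rest ; count-B∖A = proj₁ B∖A,A∩B
    ; count-s-A∩B = proj₁ s,outside ; count-A∩B-outside = proj₂ s,outside }
    where
    a = count (cutʷ inA)
    b = count (cutʷ inB)
    x = count (cutʷ (inA ∖ʳ inB))
    y = count (cutʷ (inB ∖ʳ inA))
    c = count (betweenʷ (inA ∩ʳ inB) (∁ʳ (inA ∪ʳ inB)))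
    1≤c : 1 ≤ c
    1≤c = subst (1 ≤_) (sym between-A∩B-out) (≤-trans 1≤count-s-A∩B (m≤m+n _ _))
    2k+2 : ∀ k → suc k + suc k ≡ k + (k + (1 + 1))
    2k+2 = solve-∀
    x+y+2c≤ : x + (y + (c + c)) ≤ k + (k + (1 + 1))
    x+y+2c≤ = subst₂ _≤_ cut-A+cut-B (2k+2 k) (+-mono-≤ count-A≤ count-B≤)
    A∖B,rest = +-≤-tight k≤count-A∖B (+-mono-≤ k≤count-B∖A (+-mono-≤ 1≤c 1≤c)) x+y+2c≤
    B∖A,A∩B = +-≤-tight k≤count-B∖A (+-mono-≤ 1≤c 1≤c) (≤-reflexive (proj₂ A∖B,rest))
    c≡1 : c ≡ 1
    c≡1 = ≤-antisym (+-cancelˡ-≤ 1 c 1 (≤-trans (+-monoˡ-≤ c 1≤c) (≤-reflexive (proj₂ B∖A,A∩B)))) 1≤c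
    s,outside = +-≤-tight {m′ = 1} {n′ = 0} 1≤count-s-A∩B z≤n
      (subst (_≤ 1 + 0) between-A∩B-out (≤-reflexive c≡1))
    A,B = +-≤-tight count-A≤ count-B≤ (≤-reflexive (begin
      suc k + suc k                  ≡⟨ 2k+2 k ⟩
      k + (k + (1 + 1))              ≡⟨ cong₂ (λ x y → x + (y + (1 + 1))) (proj₁ A∖B,rest) (proj₁ B∖A,A∩B) ⟨
      x + (y + (1 + 1))              ≡⟨ cong (λ c → x + (y + (c + c))) c≡1 ⟨
      x + (y + (c + c))              ≡⟨ cut-A+cut-B ⟨
      a + b                          ∎))
      where open ≡-Reasoning

  module WithOutsideVertex {w : Vertex G} (w≢s : w ≢ s) (w∉A : memb A w ≡ false) (w∉B : memb B w ≡ false)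
    where
    open Tight tight

    ∈A⇒∈A∪B : ∀ {v} → memb A v ≡ true → memb (A ∪ B) v ≡ true
    ∈A⇒∈A∪B {v} v∈A = trans (memb-∪ A B v) (cong (_∨ memb B v) v∈A)

    ∈B⇒∈A∪B : ∀ {v} → memb B v ≡ true → memb (A ∪ B) v ≡ true
    ∈B⇒∈A∪B {v} v∈B = trans (memb-∪ A B v) (trans (cong (memb A v ∨_) v∈B) (∨-zeroʳ (memb A v)))

    liftable⇒k+2≤count-A∪B : ∀ {f f′} → Liftable G s k f f′ → f ≢ f′ → At G s f → At G s f′ →
      memb (A ∪ B) (other G s f) ≡ true → memb (A ∪ B) (other G s f′) ≡ true →
      k + 2 ≤ count (cutʷ (inA ∪ʳ inB))
    liftable⇒k+2≤count-A∪B liftable f≢f′ f-at f′-at v∈ v′∈ =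
      subst (k + 2 ≤_) (cutSize≡count (represents-∪ represents-A represents-B))
        (liftable⇒k+2≤cutSize {G} liftable f≢f′ f-at f′-at (A ∪ B)
          (trans (memb-∪ A B s) (cong₂ _∨_ (Dangerousᵇ.s∉ DA) (Dangerousᵇ.s∉ DB))) v∈ v′∈
          (trans (memb-∪ A B w) (cong₂ _∨_ w∉A w∉B)) w≢s)

    -- Otherwise the edge of J ∖ I would be non-adjacent to all of I, hence in I.
    k+2≤count-A∪B : k + 2 ≤ count (cutʷ (inA ∪ʳ inB))
    k+2≤count-A∪B with k + 2 ≤? count (cutʷ (inA ∪ʳ inB))
    ... | yes k+2≤ = k+2≤
    ... | no  k+2≰ = ⊥-elim (true≢false (trans (sym (∈⇒memb (I→A g g∈I))) (EdgeAt.A? J∖I-edge)))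
      where
      g = EdgeAt.edge J∖I-edge
      g∈A∪B = ∈B⇒∈A∪B (EdgeAt.B? J∖I-edge)
      g∈I : g ∈ I
      g∈I = maxIndependent-absorbs {G} {s} {k} mI (EdgeAt.at J∖I-edge) λ h h∈I →
        let h∈A∪B = ∈A⇒∈A∪B (∈⇒memb (I→A h h∈I)) in
        (λ (g≢h , g-at , h-at , liftable) →
           k+2≰ (liftable⇒k+2≤count-A∪B liftable g≢h g-at h-at g∈A∪B h∈A∪B)) ,
        (λ (h≢g , h-at , g-at , liftable) →
           k+2≰ (liftable⇒k+2≤count-A∪B liftable h≢g h-at g-at h∈A∪B g∈A∪B))

    cut-A+cut-B≡∩∪ : count (cutʷ inA) + count (cutʷ inB)
      ≡ count (cutʷ (inA ∩ʳ inB)) + (count (cutʷ (inA ∪ʳ inB))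
          + (count (betweenʷ (inA ∖ʳ inB) (inB ∖ʳ inA)) + count (betweenʷ (inA ∖ʳ inB) (inB ∖ʳ inA))))
    cut-A+cut-B≡∩∪ = Σcount-≡₀ (cutʷ inA ∷ cutʷ inB ∷ [])
      (cutʷ (inA ∩ʳ inB) ∷ cutʷ (inA ∪ʳ inB) ∷ betweenʷ (inA ∖ʳ inB) (inB ∖ʳ inA)
        ∷ betweenʷ (inA ∖ʳ inB) (inB ∖ʳ inA) ∷ []) tt

    count-A∩B : count (cutʷ (inA ∩ʳ inB)) ≡ k
    count-A∩B = ≤-antisym (+-cancelʳ-≤ (k + 2) _ _ (begin
      count (cutʷ (inA ∩ʳ inB)) + (k + 2)
        ≤⟨ +-monoʳ-≤ (count (cutʷ (inA ∩ʳ inB))) (≤-trans k+2≤count-A∪B (m≤m+n _ _)) ⟩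
      count (cutʷ (inA ∩ʳ inB)) + (count (cutʷ (inA ∪ʳ inB)) + _)
        ≡⟨ cut-A+cut-B≡∩∪ ⟨
      count (cutʷ inA) + count (cutʷ inB)
        ≡⟨ cong₂ _+_ count-A count-B ⟩
      suc k + suc k
        ≡⟨ 2k+2 k ⟩
      k + (k + 2) ∎))
      (k≤count-cutʷ connected (inA ∩ʳ inB) refl (cong₂ _∧_ common∈A common∈B) (cong (_∧ memb B w) w∉A) w≢s)
      where
      open ≤-Reasoning
      2k+2 : ∀ k → suc k + suc k ≡ k + (k + 2)
      2k+2 = solve-∀

    half : ∀ {a c d} h → a ≡ suc k → c ≡ k → d ≡ k → a + (h + h) ≡ c + d → 2 * h + 1 ≡ k
    half h refl refl refl a+2h≡c+d = +-cancelˡ-≡ k _ _ (trans (2h+1 k h) a+2h≡c+d)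
      where
      2h+1 : ∀ k h → k + (2 * h + 1) ≡ suc k + (h + h)
      2h+1 = solve-∀

    A∩B-to-B∖A : 2 * count (betweenʷ (inA ∩ʳ inB) (inB ∖ʳ inA)) + 1 ≡ k
    A∩B-to-B∖A = half (count (betweenʷ (inA ∩ʳ inB) (inB ∖ʳ inA))) count-B count-A∩B count-B∖A (Σcount-≡₀
      (cutʷ inB ∷ betweenʷ (inA ∩ʳ inB) (inB ∖ʳ inA) ∷ betweenʷ (inA ∩ʳ inB) (inB ∖ʳ inA) ∷ [])
      (cutʷ (inA ∩ʳ inB) ∷ cutʷ (inB ∖ʳ inA) ∷ []) tt)

    A∩B-to-A∖B : 2 * count (betweenʷ (inA ∩ʳ inB) (inA ∖ʳ inB)) + 1 ≡ k
    A∩B-to-A∖B = half (count (betweenʷ (inA ∩ʳ inB) (inA ∖ʳ inB))) count-A count-A∩B count-A∖B (Σcount-≡₀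
      (cutʷ inA ∷ betweenʷ (inA ∩ʳ inB) (inA ∖ʳ inB) ∷ betweenʷ (inA ∩ʳ inB) (inA ∖ʳ inB) ∷ [])
      (cutʷ (inA ∩ʳ inB) ∷ cutʷ (inA ∖ʳ inB) ∷ []) tt)

-- Three consecutive maximal independent sets

record Configuration : Set where
  field
    G : Graph
    s : Vertex G
    k : ℕ
    loopless : Loopless G
    connected : SKConnected G s k
    k≥2 : 2 ≤ k
    I₁ I₂ I₃ : ESet G
    m₁ : MaxIndependent G s k I₁
    m₂ : MaxIndependent G s k I₂
    m₃ : MaxIndependent G s k I₃
    I₁≢I₂ : I₁ ≢ I₂
    I₃≢I₂ : I₃ ≢ I₂
    I₁≢I₃ : I₁ ≢ I₃
    e₁₂ e₃₂ : Edge G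
    e₁₂∈I₁ : e₁₂ ∈ I₁
    e₁₂∈I₂ : e₁₂ ∈ I₂
    e₃₂∈I₃ : e₃₂ ∈ I₃
    e₃₂∈I₂ : e₃₂ ∈ I₂
    A₁ A₂ A₃ : VSet G
    D₁ : Dangerousᵇ G s k A₁
    D₂ : Dangerousᵇ G s k A₂
    D₃ : Dangerousᵇ G s k A₃
    I₁→A₁ : ContainsOtherEnds G s I₁ A₁
    I₂→A₂ : ContainsOtherEnds G s I₂ A₂
    I₃→A₃ : ContainsOtherEnds G s I₃ A₃

mirror : Configuration → Configuration
mirror C = record
  { G = G ; s = s ; k = k ; loopless = loopless ; connected = connected ; k≥2 = k≥2
  ; I₁ = I₃ ; I₂ = I₂ ; I₃ = I₁ ; m₁ = m₃ ; m₂ = m₂ ; m₃ = m₁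
  ; I₁≢I₂ = I₃≢I₂ ; I₃≢I₂ = I₁≢I₂ ; I₁≢I₃ = λ I₃≡I₁ → I₁≢I₃ (sym I₃≡I₁)
  ; e₁₂ = e₃₂ ; e₃₂ = e₁₂ ; e₁₂∈I₁ = e₃₂∈I₃ ; e₁₂∈I₂ = e₃₂∈I₂ ; e₃₂∈I₃ = e₁₂∈I₁ ; e₃₂∈I₂ = e₁₂∈I₂
  ; A₁ = A₃ ; A₂ = A₂ ; A₃ = A₁ ; D₁ = D₃ ; D₂ = D₂ ; D₃ = D₁
  ; I₁→A₁ = I₃→A₃ ; I₂→A₂ = I₂→A₂ ; I₃→A₃ = I₁→A₁ }
  where open Configuration C

module ThreeSets (C : Configuration) where

  open Configuration C public

  open Frame G s loopless (A₁ ∷ A₂ ∷ A₃ ∷ []) (Dangerousᵇ.s∉ D₁ ∷ Dangerousᵇ.s∉ D₂ ∷ Dangerousᵇ.s∉ D₃ ∷ [])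
    public

  module P₁₂ = Pair loopless connected m₁ m₂ I₁≢I₂ e₁₂∈I₁ e₁₂∈I₂ D₁ D₂ I₁→A₁ I₂→A₂
  module P₃₂ = Pair loopless connected m₃ m₂ I₃≢I₂ e₃₂∈I₃ e₃₂∈I₂ D₃ D₂ I₃→A₃ I₂→A₂
  module T₁₂ = P₁₂.Tight P₁₂.tight
  module T₃₂ = P₃₂.Tight P₃₂.tight

  in₁ in₂ in₃ : Region 3
  in₁ = inside zero
  in₂ = inside (suc zero)
  in₃ = inside (suc (suc zero))

  cellOf-outside-s : ∀ {v a b c} → v ≢ s → memb A₁ v ≡ a → memb A₂ v ≡ b → memb A₃ v ≡ c →
    cellOf v ≡ (false , a ∷ b ∷ c ∷ [])
  cellOf-outside-s v≢s refl refl refl rewrite ≢⇒==-false v≢s = refl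

  record PrivateVertex (X Y Z : VSet G) : Set where
    constructor privateVertex
    field
      vertex : Vertex G
      ≢s : vertex ≢ s
      ∈X : memb X vertex ≡ true
      ∉Y : memb Y vertex ≡ false
      ∉Z : memb Z vertex ≡ false

  -- An edge of I₃ ∖ I₂ ends in A₃ ∖ A₂; if it also ended in A₁, it could not be lifted with
  -- any edge of I₂ (all of whose ends lie in the dangerous A₁ or A₃), so it would lie in I₂.
  private-vertex-A₃ : (∀ {g} → g ∈ I₂ → memb A₁ (other G s g) ≡ true ⊎ memb A₃ (other G s g) ≡ true) →
    PrivateVertex A₃ A₁ A₂
  private-vertex-A₃ I₂→A₁∪A₃ = from-edge P₃₂.I∖J-edge
    where
    from-edge : EdgeAt G s A₃ A₂ true false → PrivateVertex A₃ A₁ A₂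
    from-edge record { edge = f ; at = f-at ; A? = f∈A₃ ; B? = f∉A₂ } with memb A₁ (other G s f) in f∈?A₁
    ... | false = privateVertex (other G s f) (other≢s {G} loopless f-at) f∈A₃ f∈?A₁ f∉A₂
    ... | true  = ⊥-elim (true≢false (trans (sym (∈⇒memb (I₂→A₂ f f∈I₂))) f∉A₂))
      where
      non-adjacent : ∀ {g} → memb A₁ (other G s g) ≡ true ⊎ memb A₃ (other G s g) ≡ true →
        ¬ LAdj G s k f g × ¬ LAdj G s k g f
      non-adjacent (inj₁ g∈A₁) =
        (λ (f≢g , _ , g-at , liftable) → dangerous⇒¬liftable D₁ f≢g f-at g-at f∈?A₁ g∈A₁ liftable) ,
        (λ (g≢f , g-at , _ , liftable) → dangerous⇒¬liftable D₁ g≢f g-at f-at g∈A₁ f∈?A₁ liftable)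
      non-adjacent (inj₂ g∈A₃) =
        (λ (f≢g , _ , g-at , liftable) → dangerous⇒¬liftable D₃ f≢g f-at g-at f∈A₃ g∈A₃ liftable) ,
        (λ (g≢f , g-at , _ , liftable) → dangerous⇒¬liftable D₃ g≢f g-at f-at g∈A₃ f∈A₃ liftable)
      f∈I₂ : f ∈ I₂
      f∈I₂ = maxIndependent-absorbs {G} {s} {k} m₂ f-at λ g g∈I₂ → non-adjacent (I₂→A₁∪A₃ g∈I₂)

  A₁₂ A₃₂ Tʳ Rʳ : Region 3
  A₁₂ = in₁ ∩ʳ in₂ ∖ʳ in₃
  A₃₂ = in₃ ∩ʳ in₂ ∖ʳ in₁
  Tʳ = in₁ ∩ʳ in₂ ∩ʳ in₃
  Rʳ = in₂ ∖ʳ (in₁ ∪ʳ in₃)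

  represents-A₁ : Represents A₁ in₁
  represents-A₁ = represents-inside zero

  represents-A₂ : Represents A₂ in₂
  represents-A₂ = represents-inside (suc zero)

  represents-A₃ : Represents A₃ in₃
  represents-A₃ = represents-inside (suc (suc zero))

  out₁₂ out₃₂ : Region 3
  out₁₂ = ∁ʳ (atS ∪ʳ in₁ ∪ʳ in₂)
  out₃₂ = ∁ʳ (atS ∪ʳ in₃ ∪ʳ in₂)

  common : Vertex G
  common = P₁₂.common

  1≤count-s-T : memb A₃ common ≡ true → 1 ≤ count (betweenʷ atS Tʳ)
  1≤count-s-T common∈A₃ = subst (_≤ count (betweenʷ atS Tʳ))
    (betweenʷ-atS≡1 Tʳ refl P₁₂.e-at (cong₂ _∧_ (cong₂ _∧_ P₁₂.common∈A P₁₂.common∈B) common∈A₃))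
    (term≤sum _ e₁₂)

  module A₁∩A₂⊆A₃ (A₁₂-empty : ∀ v → A₁₂ (cellOf v) ≡ false) where

    common∈A₃ : memb A₃ common ≡ true
    common∈A₃ with memb A₃ common in c∈?A₃ | A₁₂-empty common
    ... | true  | _       = refl
    ... | false | c∉A₁₂ =
      ⊥-elim (true≢false (trans (sym (cong₂ (λ a b → (a ∧ b) ∧ true) P₁₂.common∈A P₁₂.common∈B)) c∉A₁₂))

    v∈A₁∖A₃⇒v∉A₂ : ∀ {v} → v ≢ s → memb A₁ v ≡ true → memb A₃ v ≡ false → memb A₂ v ≡ false
    v∈A₁∖A₃⇒v∉A₂ {v} v≢s v∈A₁ v∉A₃ with memb A₂ v in v∈?A₂
    ... | false = refl
    ... | true  = ⊥-elim (true≢false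
      (trans (sym (cong A₁₂ (cellOf-outside-s v≢s v∈A₁ v∈?A₂ v∉A₃))) (A₁₂-empty v)))

    private-A₁ : PrivateVertex A₁ A₂ A₃
    private-A₁ with maxIndependent-≢⇒∃∖ {G} {s} {k} (proj₁ m₃) m₁ (λ I₃≡I₁ → I₁≢I₃ (sym I₃≡I₁))
    ... | f , f∈I₁ , f∉I₃ = privateVertex (other G s f) f≢s f∈A₁ (v∈A₁∖A₃⇒v∉A₂ f≢s f∈A₁ f∉A₃) f∉A₃
      where
      f-at = proj₁ (proj₁ m₁) f f∈I₁
      f≢s = other≢s {G} loopless f-at
      f∈A₁ = ∈⇒memb (I₁→A₁ f f∈I₁)
      f∉A₃ = ∉maxIndependent⇒other∉ {G} {s} {k} m₃ D₃ I₃→A₃ f∉I₃ f-at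

    -- e₁₂ ends in A₃ ∩ A₂, which receives a single edge from s.
    only-e₁₂-into-A₃∩A₂ : ∀ {f} → At G s f → memb A₃ (other G s f) ≡ true → memb A₂ (other G s f) ≡ true →
      e₁₂ ≡ f
    only-e₁₂-into-A₃∩A₂ {f} f-at f∈A₃ f∈A₂ with e₁₂ ≟ f
    ... | yes e₁₂≡f = e₁₂≡f
    ... | no  e₁₂≢f = ⊥-elim (<⇒≱ (s≤s (s≤s z≤n)) (begin
      2                                      ≡⟨ cong₂ _+_ (one P₁₂.e-at (cong₂ _∧_ common∈A₃ P₁₂.common∈B))
                                                            (one f-at (cong₂ _∧_ f∈A₃ f∈A₂)) ⟨
      at-e (typeOf e₁₂) + at-e (typeOf f)    ≤⟨ two-terms≤sum (λ g → at-e (typeOf g)) e₁₂≢f ⟩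
      count (betweenʷ atS (in₃ ∩ʳ in₂))      ≡⟨ T₃₂.count-s-A∩B ⟩
      1                                      ∎))
      where
      open ≤-Reasoning
      at-e = betweenʷ atS (in₃ ∩ʳ in₂)
      one = betweenʷ-atS≡1 (in₃ ∩ʳ in₂) refl

    private-A₃ : PrivateVertex A₃ A₁ A₂
    private-A₃ with maxIndependent-≢⇒∃∖ {G} {s} {k} (proj₁ m₁) m₃ I₁≢I₃
    ... | f , f∈I₃ , f∉I₁ = privateVertex (other G s f) (other≢s {G} loopless f-at) f∈A₃ f∉A₁ f∉A₂
      where
      f-at = proj₁ (proj₁ m₃) f f∈I₃
      f∈A₃ = ∈⇒memb (I₃→A₃ f f∈I₃)
      f∉A₁ = ∉maxIndependent⇒other∉ {G} {s} {k} m₁ D₁ I₁→A₁ f∉I₁ f-at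
      f∉A₂ : memb A₂ (other G s f) ≡ false
      f∉A₂ with memb A₂ (other G s f) in f∈?A₂
      ... | false = refl
      ... | true  = ⊥-elim (true≢false (trans (sym P₁₂.common∈A)
        (trans (cong (λ g → memb A₁ (other G s g)) (only-e₁₂-into-A₃∩A₂ f-at f∈A₃ f∈?A₂)) f∉A₁)))

    module W₁ = PrivateVertex private-A₁
    module W₃ = PrivateVertex private-A₃
    module O₁₂ = P₁₂.WithOutsideVertex W₃.≢s W₃.∉Y W₃.∉Z
    module O₃₂ = P₃₂.WithOutsideVertex W₁.≢s W₁.∉Z W₁.∉Y

    cellOf-common : cellOf common ≡ (false , true ∷ true ∷ true ∷ [])
    cellOf-common = cellOf-outside-s P₁₂.common≢s P₁₂.common∈A P₁₂.common∈B common∈A₃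

    k≤count-A₁∖A₃ : k ≤ count (cutʷ (in₁ ∖ʳ in₃))
    k≤count-A₁∖A₃ = k≤count-cutʷ connected (in₁ ∖ʳ in₃) refl
      (cong₂ (λ a c → a ∧ not c) W₁.∈X W₁.∉Z) (cong (in₁ ∖ʳ in₃) cellOf-common) P₁₂.common≢s

    k≤count-A₃∖A₁ : k ≤ count (cutʷ (in₃ ∖ʳ in₁))
    k≤count-A₃∖A₁ = k≤count-cutʷ connected (in₃ ∖ʳ in₁) refl
      (cong₂ (λ c a → c ∧ not a) W₃.∈X W₃.∉Y) (cong (in₃ ∖ʳ in₁) cellOf-common) P₁₂.common≢s

    count-A₁∩A₃-out≤1 : count (betweenʷ (in₁ ∩ʳ in₃) (∁ʳ (in₁ ∪ʳ in₃))) ≤ 1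
    count-A₁∩A₃-out≤1 = *-cancelˡ-≤ 2 (subst (_≤ 2) (cong (b +_) (sym (+-identityʳ b)))
      (+-cancelˡ-≤ k _ _ (+-cancelˡ-≤ k _ _ (begin
        k + (k + (b + b))
          ≤⟨ +-mono-≤ k≤count-A₁∖A₃ (+-monoˡ-≤ (b + b) k≤count-A₃∖A₁) ⟩
        count (cutʷ (in₁ ∖ʳ in₃)) + (count (cutʷ (in₃ ∖ʳ in₁)) + (b + b))
          ≡⟨ Σcount-≡₀ (cutʷ in₁ ∷ cutʷ in₃ ∷ [])
                       (cutʷ (in₁ ∖ʳ in₃) ∷ cutʷ (in₃ ∖ʳ in₁) ∷ out ∷ out ∷ []) tt ⟨
        count (cutʷ in₁) + count (cutʷ in₃)
          ≡⟨ cong₂ _+_ T₁₂.count-A T₃₂.count-A ⟩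
        suc k + suc k
          ≡⟨ 2k+2 k ⟩
        k + (k + 2) ∎))))
      where
      open ≤-Reasoning
      out = betweenʷ (in₁ ∩ʳ in₃) (∁ʳ (in₁ ∪ʳ in₃))
      b = count out
      2k+2 : ∀ k → suc k + suc k ≡ k + (k + 2)
      2k+2 = solve-∀

    count-T-R : count (betweenʷ Tʳ Rʳ) ≡ 0
    count-T-R = n≤0⇒n≡0 (+-cancelˡ-≤ 1 _ 0 (begin
      1 + count (betweenʷ Tʳ Rʳ)
        ≤⟨ +-monoˡ-≤ _ (1≤count-s-T common∈A₃) ⟩
      count (betweenʷ atS Tʳ) + count (betweenʷ Tʳ Rʳ)
        ≤⟨ Σcount-≤₀ (betweenʷ atS Tʳ ∷ betweenʷ Tʳ Rʳ ∷ [])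
                     (betweenʷ (in₁ ∩ʳ in₃) (∁ʳ (in₁ ∪ʳ in₃)) ∷ []) tt ⟩
      count (betweenʷ (in₁ ∩ʳ in₃) (∁ʳ (in₁ ∪ʳ in₃)))
        ≤⟨ count-A₁∩A₃-out≤1 ⟩
      1 ∎))
      where open ≤-Reasoning

    count-A₃₂+1 : count (cutʷ A₃₂) + 1 ≡ k
    count-A₃₂+1 = begin
      a + 1       ≡⟨ cong (_+ 1) a≡q+q ⟩
      q + q + 1   ≡⟨ cong (λ q′ → q + q′ + 1) (+-identityʳ q) ⟨
      2 * q + 1   ≡⟨ O₃₂.A∩B-to-B∖A ⟩
      k           ∎
      where
      open ≡-Reasoning
      a = count (cutʷ A₃₂)
      q = count (betweenʷ (in₃ ∩ʳ in₂) (in₂ ∖ʳ in₃))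
      t = count (betweenʷ Tʳ Rʳ)
      y = count (cutʷ (in₂ ∖ʳ in₃))
      counting : a + (y + (t + t)) ≡ count (cutʷ (in₂ ∖ʳ in₁)) + (q + q)
      counting = Σcount-≡ (∁ʳ A₁₂) (∁-holds A₁₂ A₁₂-empty)
        (cutʷ A₃₂ ∷ cutʷ (in₂ ∖ʳ in₃) ∷ betweenʷ Tʳ Rʳ ∷ betweenʷ Tʳ Rʳ ∷ [])
        (cutʷ (in₂ ∖ʳ in₁) ∷ betweenʷ (in₃ ∩ʳ in₂) (in₂ ∖ʳ in₃) ∷ betweenʷ (in₃ ∩ʳ in₂) (in₂ ∖ʳ in₃) ∷ []) tt
      a≡q+q : a ≡ q + q
      a≡q+q = +-cancelʳ-≡ k a (q + q) (begin
        a + k                                ≡⟨ cong (a +_) (+-identityʳ k) ⟨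
        a + (k + 0)                          ≡⟨ cong₂ (λ y t → a + (y + (t + t))) T₃₂.count-B∖A count-T-R ⟨
        a + (y + (t + t))                    ≡⟨ counting ⟩
        count (cutʷ (in₂ ∖ʳ in₁)) + (q + q)  ≡⟨ cong (_+ (q + q)) T₁₂.count-B∖A ⟩
        k + (q + q)                          ≡⟨ +-comm k (q + q) ⟩
        q + q + k                            ∎)

    -- If A₃₂ is non-empty its cut has at least k edges; if it is empty, then A₁ ∩ A₂ sends
    -- no edge to A₂ ∖ A₁ (all such edges would go from T to R), forcing k = 1.
    impossible : Empty.⊥
    impossible with occupied? A₃₂
    ... | inj₁ (a , a∈A₃₂) = 1+n≰n (≤-trans (≤-reflexive (trans (+-comm 1 _) count-A₃₂+1))
        (k≤count-cutʷ connected A₃₂ refl a∈A₃₂ (cong A₃₂ cellOf-common) P₁₂.common≢s))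
    ... | inj₂ A₃₂-empty = <⇒≱ (s≤s (s≤s z≤n)) (subst (2 ≤_) (begin
        k                     ≡⟨ O₁₂.A∩B-to-B∖A ⟨
        2 * p + 1             ≡⟨ cong (λ p → 2 * p + 1) (n≤0⇒n≡0 (≤-trans p≤t (≤-reflexive count-T-R))) ⟩
        1                     ∎) k≥2)
      where
      open ≡-Reasoning
      p = count (betweenʷ (in₁ ∩ʳ in₂) (in₂ ∖ʳ in₁))
      p≤t : p ≤ count (betweenʷ Tʳ Rʳ)
      p≤t = Σcount-≤ (∁ʳ A₁₂ ∩ʳ ∁ʳ A₃₂)
        (∩-holds (∁ʳ A₁₂) (∁ʳ A₃₂) (∁-holds A₁₂ A₁₂-empty) (∁-holds A₃₂ A₃₂-empty))
        (betweenʷ (in₁ ∩ʳ in₂) (in₂ ∖ʳ in₁) ∷ []) (betweenʷ Tʳ Rʳ ∷ []) tt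

  A₁₂-occupied : Σ (Vertex G) λ v → A₁₂ (cellOf v) ≡ true
  A₁₂-occupied with occupied? A₁₂
  ... | inj₁ occupied = occupied
  ... | inj₂ empty    = ⊥-elim (A₁∩A₂⊆A₃.impossible empty)

module Conclusions (C : Configuration) where
  open ThreeSets C
  module Mirror = ThreeSets (mirror C)

  a₁₂ a₃₂ : Vertex G
  a₁₂ = proj₁ A₁₂-occupied
  a₃₂ = proj₁ Mirror.A₁₂-occupied

  a₁₂-bits : memb A₁ a₁₂ ≡ true × memb A₂ a₁₂ ≡ true × memb A₃ a₁₂ ≡ false
  a₁₂-bits = ∧∧not≡true {memb A₁ a₁₂} {memb A₂ a₁₂} {memb A₃ a₁₂} (proj₂ A₁₂-occupied)

  a₃₂-bits : memb A₃ a₃₂ ≡ true × memb A₂ a₃₂ ≡ true × memb A₁ a₃₂ ≡ false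
  a₃₂-bits = ∧∧not≡true {memb A₃ a₃₂} {memb A₂ a₃₂} {memb A₁ a₃₂} (proj₂ Mirror.A₁₂-occupied)

  a₁₂≢s : a₁₂ ≢ s
  a₁₂≢s = memb-≢ A₂ (proj₁ (proj₂ a₁₂-bits)) (Dangerousᵇ.s∉ D₂)

  a₃₂≢s : a₃₂ ≢ s
  a₃₂≢s = memb-≢ A₂ (proj₁ (proj₂ a₃₂-bits)) (Dangerousᵇ.s∉ D₂)

  cellOf-a₁₂ : cellOf a₁₂ ≡ (false , true ∷ true ∷ false ∷ [])
  cellOf-a₁₂ = cellOf-outside-s a₁₂≢s (proj₁ a₁₂-bits) (proj₁ (proj₂ a₁₂-bits)) (proj₂ (proj₂ a₁₂-bits))

  cellOf-a₃₂ : cellOf a₃₂ ≡ (false , false ∷ true ∷ true ∷ [])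
  cellOf-a₃₂ = cellOf-outside-s a₃₂≢s (proj₂ (proj₂ a₃₂-bits)) (proj₁ (proj₂ a₃₂-bits)) (proj₁ a₃₂-bits)

  ρ : ℕ
  ρ = count (betweenʷ Rʳ (∁ʳ in₂))

  -- δ(A₂ ∖ A₃) and δ(A₂ ∖ A₁), both of size k, cover δ(A₁₂) and δ(A₃₂), each of size at least k,
  -- and count twice every edge leaving R = A₂ ∖ (A₁ ∪ A₃) for the complement of A₂.
  ρ≡0 : ρ ≡ 0
  ρ≡0 = n≤0⇒n≡0 (≤-trans (m≤n+m ρ ρ) (+-cancelˡ-≤ k _ _ (+-cancelˡ-≤ k _ _ (begin
    k + (k + (ρ + ρ))
      ≤⟨ +-mono-≤ (k≤count-cutʷ connected A₁₂ refl (cong A₁₂ cellOf-a₁₂) (cong A₁₂ cellOf-a₃₂) a₃₂≢s)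
           (+-monoˡ-≤ (ρ + ρ)
             (k≤count-cutʷ connected A₃₂ refl (cong A₃₂ cellOf-a₃₂) (cong A₃₂ cellOf-a₁₂) a₁₂≢s)) ⟩
    count (cutʷ A₁₂) + (count (cutʷ A₃₂) + (ρ + ρ))
      ≤⟨ Σcount-≤₀ (cutʷ A₁₂ ∷ cutʷ A₃₂ ∷ betweenʷ Rʳ (∁ʳ in₂) ∷ betweenʷ Rʳ (∁ʳ in₂) ∷ [])
                   (cutʷ (in₂ ∖ʳ in₃) ∷ cutʷ (in₂ ∖ʳ in₁) ∷ []) tt ⟩
    count (cutʷ (in₂ ∖ʳ in₃)) + count (cutʷ (in₂ ∖ʳ in₁))
      ≡⟨ cong₂ _+_ T₃₂.count-B∖A T₁₂.count-B∖A ⟩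
    k + k
      ≡⟨ cong (k +_) (+-identityʳ k) ⟨
    k + (k + 0) ∎))))
    where
    open ≤-Reasoning

  count-s-R≡0 : count (betweenʷ atS Rʳ) ≡ 0
  count-s-R≡0 = n≤0⇒n≡0 (≤-trans (Σcount-≤₀ (betweenʷ atS Rʳ ∷ []) (betweenʷ Rʳ (∁ʳ in₂) ∷ []) tt)
                                 (≤-reflexive ρ≡0))

  I₂→A₁∪A₃ : ∀ {g} → g ∈ I₂ → memb A₁ (other G s g) ≡ true ⊎ memb A₃ (other G s g) ≡ true
  I₂→A₁∪A₃ {g} g∈I₂ with memb A₁ (other G s g) in g∈?A₁ | memb A₃ (other G s g) in g∈?A₃
  ... | true  | _     = inj₁ refl
  ... | false | true  = inj₂ refl
  ... | false | false = ⊥-elim (1≢0 (trans (sym g-counted) (sum≡0⇒term≡0 _ count-s-R≡0 g)))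
    where
    1≢0 : 1 ≢ 0
    1≢0 ()
    g-counted : betweenʷ atS Rʳ (typeOf g) ≡ 1
    g-counted = betweenʷ-atS≡1 Rʳ refl (proj₁ (proj₁ m₂) g g∈I₂)
      (cong₂ (λ b a∪c → b ∧ not a∪c) (∈⇒memb (I₂→A₂ g g∈I₂)) (cong₂ _∨_ g∈?A₁ g∈?A₃))

  module W₃ = PrivateVertex (private-vertex-A₃ I₂→A₁∪A₃)
  module W₁ = Mirror.PrivateVertex (Mirror.private-vertex-A₃ (λ g∈I₂ → swap (I₂→A₁∪A₃ g∈I₂)))
  module O₁₂ = P₁₂.WithOutsideVertex W₃.≢s W₃.∉Y W₃.∉Z
  module O₃₂ = P₃₂.WithOutsideVertex W₁.≢s W₁.∉Y W₁.∉Z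

  halves : ∀ {p q} → 2 * p + 1 ≡ k → 2 * q + 1 ≡ k → suc (p + q) ≡ k
  halves {p} {q} 2p+1≡k 2q+1≡k = begin
    suc (p + q)   ≡⟨ cong (λ q → suc (p + q)) q≡p ⟩
    suc (p + p)   ≡⟨ double+1 p ⟩
    2 * p + 1     ≡⟨ 2p+1≡k ⟩
    k             ∎
    where
    open ≡-Reasoning
    double+1 : ∀ p → suc (p + p) ≡ 2 * p + 1
    double+1 = solve-∀
    q≡p : q ≡ p
    q≡p = *-cancelˡ-≡ q p 2 (+-cancelʳ-≡ 1 (2 * q) (2 * p) (trans 2q+1≡k (sym 2p+1≡k)))

  p₁ q₃ p₂ q₂ : ℕ
  p₁ = count (betweenʷ (in₁ ∩ʳ in₂) (in₁ ∖ʳ in₂))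
  q₃ = count (betweenʷ (in₃ ∩ʳ in₂) (in₃ ∖ʳ in₂))
  p₂ = count (betweenʷ (in₁ ∩ʳ in₂) (in₂ ∖ʳ in₁))
  q₂ = count (betweenʷ (in₃ ∩ʳ in₂) (in₂ ∖ʳ in₃))

  A₁₃ : Region 3
  A₁₃ = in₁ ∩ʳ in₃ ∖ʳ in₂

  -- Every edge of δ(A₂) leaves R, or leaves A₁ ∩ A₂ or A₃ ∩ A₂ towards s, A₁ ∖ A₂, A₃ ∖ A₂ or the
  -- outside; the edges from T to s or to A₁₃ are counted in both of the last two ways.
  T-A₁₃+s-T≡0 : count (betweenʷ Tʳ A₁₃) + count (betweenʷ atS Tʳ) ≡ 0
  T-A₁₃+s-T≡0 = n≤0⇒n≡0 (+-cancelˡ-≤ (suc k) _ 0 (begin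
    suc k + z
      ≡⟨ cong (_+ z) T₁₂.count-B ⟨
    count (cutʷ in₂) + z
      ≤⟨ Σcount-≤₀ (cutʷ in₂ ∷ betweenʷ Tʳ A₁₃ ∷ betweenʷ atS Tʳ ∷ [])
           (betweenʷ (in₁ ∩ʳ in₂) (in₁ ∖ʳ in₂) ∷ betweenʷ atS (in₁ ∩ʳ in₂) ∷ betweenʷ (in₁ ∩ʳ in₂) out₁₂
             ∷ betweenʷ (in₃ ∩ʳ in₂) (in₃ ∖ʳ in₂) ∷ betweenʷ atS (in₃ ∩ʳ in₂) ∷ betweenʷ (in₃ ∩ʳ in₂) out₃₂
             ∷ betweenʷ Rʳ (∁ʳ in₂) ∷ []) tt ⟩
    p₁ + (count (betweenʷ atS (in₁ ∩ʳ in₂)) + (count (betweenʷ (in₁ ∩ʳ in₂) out₁₂)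
      + (q₃ + (count (betweenʷ atS (in₃ ∩ʳ in₂)) + (count (betweenʷ (in₃ ∩ʳ in₂) out₃₂) + ρ)))))
      ≡⟨ cong₂ (λ a b → p₁ + (a + b)) T₁₂.count-s-A∩B (cong₂ _+_ T₁₂.count-A∩B-outside
           (cong₂ (λ c d → q₃ + (c + d)) T₃₂.count-s-A∩B (cong₂ _+_ T₃₂.count-A∩B-outside ρ≡0))) ⟩
    p₁ + (1 + (q₃ + 1))
      ≡⟨ shape p₁ q₃ ⟩
    suc (suc (p₁ + q₃))
      ≡⟨ cong suc (halves {p₁} {q₃} O₁₂.A∩B-to-A∖B O₃₂.A∩B-to-A∖B) ⟩
    suc k
      ≡⟨ +-identityʳ (suc k) ⟨
    suc k + 0 ∎))
    where
    open ≤-Reasoning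
    z = count (betweenʷ Tʳ A₁₃) + count (betweenʷ atS Tʳ)
    shape : ∀ p q → p + (1 + (q + 1)) ≡ suc (suc (p + q))
    shape = solve-∀

  p₂+q₂<k : p₂ + q₂ < k
  p₂+q₂<k = ≤-reflexive (halves {p₂} {q₂} O₁₂.A∩B-to-B∖A O₃₂.A∩B-to-B∖A)

  T-empty : ∀ v → Tʳ (cellOf v) ≡ false
  T-empty = cut<k⇒empty connected Tʳ refl (≤-<-trans count-T≤ p₂+q₂<k)
    (cong₂ (λ a b → (a ∧ b) ∧ memb A₃ W₁.vertex) W₁.∈X W₁.∉Z) W₁.≢s
    where
    count-T≤ : count (cutʷ Tʳ) ≤ p₂ + q₂
    count-T≤ = begin
      count (cutʷ Tʳ)
        ≤⟨ Σcount-≤₀ (cutʷ Tʳ ∷ [])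
             (betweenʷ (in₁ ∩ʳ in₂) (in₂ ∖ʳ in₁) ∷ betweenʷ (in₃ ∩ʳ in₂) (in₂ ∖ʳ in₃) ∷ betweenʷ Tʳ A₁₃
               ∷ betweenʷ atS Tʳ ∷ betweenʷ (in₁ ∩ʳ in₂) out₁₂ ∷ betweenʷ (in₃ ∩ʳ in₂) out₃₂ ∷ []) tt ⟩
      p₂ + (q₂ + (count (betweenʷ Tʳ A₁₃) + (count (betweenʷ atS Tʳ)
        + (count (betweenʷ (in₁ ∩ʳ in₂) out₁₂) + count (betweenʷ (in₃ ∩ʳ in₂) out₃₂)))))
        ≡⟨ cong (λ z → p₂ + (q₂ + z))
             (cong₂ _+_ (m+n≡0⇒m≡0 (count (betweenʷ Tʳ A₁₃)) T-A₁₃+s-T≡0)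
               (cong₂ _+_ (m+n≡0⇒n≡0 (count (betweenʷ Tʳ A₁₃)) T-A₁₃+s-T≡0)
               (cong₂ _+_ T₁₂.count-A∩B-outside T₃₂.count-A∩B-outside))) ⟩
      p₂ + (q₂ + 0)   ≡⟨ cong (p₂ +_) (+-identityʳ q₂) ⟩
      p₂ + q₂ ∎
      where open ≤-Reasoning

  R-empty : ∀ v → Rʳ (cellOf v) ≡ false
  R-empty = cut<k⇒empty connected Rʳ refl (≤-<-trans count-R≤ p₂+q₂<k)
    (cong (λ b → b ∧ not (memb A₁ W₁.vertex ∨ memb A₃ W₁.vertex)) W₁.∉Z) W₁.≢s
    where
    count-R≤ : count (cutʷ Rʳ) ≤ p₂ + q₂
    count-R≤ = begin
      count (cutʷ Rʳ)
        ≤⟨ Σcount-≤₀ (cutʷ Rʳ ∷ [])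
             (betweenʷ (in₁ ∩ʳ in₂) (in₂ ∖ʳ in₁) ∷ betweenʷ (in₃ ∩ʳ in₂) (in₂ ∖ʳ in₃)
               ∷ betweenʷ Rʳ (∁ʳ in₂) ∷ []) tt ⟩
      p₂ + (q₂ + ρ)   ≡⟨ cong (λ ρ → p₂ + (q₂ + ρ)) ρ≡0 ⟩
      p₂ + (q₂ + 0)   ≡⟨ cong (p₂ +_) (+-identityʳ q₂) ⟩
      p₂ + q₂ ∎
      where open ≤-Reasoning

  s-to-A₁∩A₂ : betweenSize G ⁅ s ⁆ (A₁ ∩ A₂) ≡ 1
  s-to-A₁∩A₂ =
    trans (betweenSize≡count represents-⁅s⁆ (represents-∩ represents-A₁ represents-A₂)) T₁₂.count-s-A∩B

  s-to-A₃∩A₂ : betweenSize G ⁅ s ⁆ (A₃ ∩ A₂) ≡ 1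
  s-to-A₃∩A₂ =
    trans (betweenSize≡count represents-⁅s⁆ (represents-∩ represents-A₃ represents-A₂)) T₃₂.count-s-A∩B

  δA₂-decomposition : ∀ e → cutB G A₂ e
    ≡ (betweenB G (A₂ ∩ A₁) (A₁ ∖ A₂) e ∨ betweenB G ⁅ s ⁆ A₂ e ∨ betweenB G (A₂ ∩ A₃) (A₃ ∖ A₂) e)
  δA₂-decomposition e = begin
    cutB G A₂ e
      ≡⟨ cutB≡cutᵗ represents-A₂ e ⟩
    cutᵗ in₂ (typeOf e)
      ≡⟨ typeOf-agree (∁ʳ Rʳ) (∁-holds Rʳ R-empty) no-outside-edge no-outside-edge-holds
                      (cutᵗ in₂) via-A₁-s-A₃ tt e ⟩
    via-A₁-s-A₃ (typeOf e)
      ≡⟨ cong₂ _∨_ (betweenB≡betweenᵗ (represents-∩ represents-A₂ represents-A₁)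
                                       (represents-∖ represents-A₁ represents-A₂) e)
           (cong₂ _∨_ (betweenB≡betweenᵗ represents-⁅s⁆ represents-A₂ e)
             (betweenB≡betweenᵗ (represents-∩ represents-A₂ represents-A₃)
                                (represents-∖ represents-A₃ represents-A₂) e)) ⟨
    betweenB G (A₂ ∩ A₁) (A₁ ∖ A₂) e ∨ betweenB G ⁅ s ⁆ A₂ e ∨ betweenB G (A₂ ∩ A₃) (A₃ ∖ A₂) e ∎
    where
    open ≡-Reasoning
    via-A₁-s-A₃ : EdgeType 3 → Bool
    via-A₁-s-A₃ t =
      betweenᵗ (in₂ ∩ʳ in₁) (in₁ ∖ʳ in₂) t ∨ betweenᵗ atS in₂ t ∨ betweenᵗ (in₂ ∩ʳ in₃) (in₃ ∖ʳ in₂) t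
    no-outside-edge : EdgeType 3 → Bool
    no-outside-edge t = not (betweenᵗ (in₁ ∩ʳ in₂) out₁₂ t) ∧ not (betweenᵗ (in₃ ∩ʳ in₂) out₃₂ t)
    no-outside-edge-holds : ∀ e → T (no-outside-edge (typeOf e))
    no-outside-edge-holds e rewrite 𝟙≡0⇒false (sum≡0⇒term≡0 _ T₁₂.count-A∩B-outside e)
                                  | 𝟙≡0⇒false (sum≡0⇒term≡0 _ T₃₂.count-A∩B-outside e) = tt

  ∣I₂∣≡2 : ∣ I₂ ∣ ≡ 2
  ∣I₂∣≡2 = trans (∣maxIndependent∣≡betweenSize {G} {s} {k} m₂ D₂ I₂→A₂)
    (trans (betweenSize≡count represents-⁅s⁆ represents-A₂) (≤-antisym at-most-2 at-least-2))
    where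
    open ≤-Reasoning
    at-most-2 : count (betweenʷ atS in₂) ≤ 2
    at-most-2 = begin
      count (betweenʷ atS in₂)
        ≤⟨ Σcount-≤₀ (betweenʷ atS in₂ ∷ [])
             (betweenʷ atS (in₁ ∩ʳ in₂) ∷ betweenʷ atS (in₃ ∩ʳ in₂) ∷ betweenʷ Rʳ (∁ʳ in₂) ∷ []) tt ⟩
      count (betweenʷ atS (in₁ ∩ʳ in₂)) + (count (betweenʷ atS (in₃ ∩ʳ in₂)) + ρ)
        ≡⟨ cong₂ _+_ T₁₂.count-s-A∩B (cong₂ _+_ T₃₂.count-s-A∩B ρ≡0) ⟩
      2 ∎
    g = EdgeAt.edge P₁₂.J∖I-edge
    e₁₂≢g : e₁₂ ≢ g
    e₁₂≢g e₁₂≡g = true≢false (trans (sym P₁₂.common∈A)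
      (trans (cong (λ f → memb A₁ (other G s f)) e₁₂≡g) (EdgeAt.A? P₁₂.J∖I-edge)))
    at-least-2 : 2 ≤ count (betweenʷ atS in₂)
    at-least-2 = subst (_≤ count (betweenʷ atS in₂))
      (cong₂ _+_ (betweenʷ-atS≡1 in₂ refl P₁₂.e-at P₁₂.common∈B)
                 (betweenʷ-atS≡1 in₂ refl (EdgeAt.at P₁₂.J∖I-edge) (EdgeAt.B? P₁₂.J∖I-edge)))
      (two-terms≤sum _ e₁₂≢g)

  A₂∖[A₁∪A₃]≡⊥ : A₂ ∖ (A₁ ∪ A₃) ≡ ⊥
  A₂∖[A₁∪A₃]≡⊥ = Empty-unique λ (v , v∈) → true≢false (trans (sym (∈⇒memb v∈))
    (trans (memb≡ (represents-∖ represents-A₂ (represents-∪ represents-A₁ represents-A₃)) v) (R-empty v)))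

  A₁∩A₂-to-A₂∩A₃ : 2 * betweenSize G (A₁ ∩ A₂) (A₂ ∩ A₃) + 1 ≡ k
  A₁∩A₂-to-A₂∩A₃ = trans (cong (λ b → 2 * b + 1) (trans
      (betweenSize≡count (represents-∩ represents-A₁ represents-A₂)
                         (represents-∩ represents-A₂ represents-A₃))
      (Σcount-≡ (∁ʳ Rʳ ∩ʳ ∁ʳ Tʳ) (∩-holds (∁ʳ Rʳ) (∁ʳ Tʳ) (∁-holds Rʳ R-empty) (∁-holds Tʳ T-empty))
        (betweenʷ (in₁ ∩ʳ in₂) (in₂ ∩ʳ in₃) ∷ []) (betweenʷ (in₁ ∩ʳ in₂) (in₂ ∖ʳ in₁) ∷ []) tt)))
    O₁₂.A∩B-to-B∖A

lemma4p7 : (G : Graph) (s : Vertex G) (k : ℕ) →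
    Loopless G → SKConnected G s k → 2 ≤ k → 4 ≤ deg G s →
    (I₁ I₂ I₃ : ESet G) →
    MaxIndependent G s k I₁ → MaxIndependent G s k I₂ → MaxIndependent G s k I₃ →
    I₁ ≢ I₂ → I₂ ≢ I₃ → I₁ ≢ I₃ →
    Nonempty (I₁ ∩ I₂) → Nonempty (I₂ ∩ I₃) →
    (A₁ A₂ A₃ : VSet G) →
    Dangerous G s k A₁ → Dangerous G s k A₂ → Dangerous G s k A₃ →
    ContainsOtherEnds G s I₁ A₁ → ContainsOtherEnds G s I₂ A₂ →
    ContainsOtherEnds G s I₃ A₃ →
    (betweenSize G ⁅ s ⁆ (A₁ ∩ A₂) ≡ 1 × betweenSize G ⁅ s ⁆ (A₃ ∩ A₂) ≡ 1)
    × (∀ e → cutB G A₂ e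
         ≡ (betweenB G (A₂ ∩ A₁) (A₁ ∖ A₂) e ∨ betweenB G ⁅ s ⁆ A₂ e
            ∨ betweenB G (A₂ ∩ A₃) (A₃ ∖ A₂) e))
    × ∣ I₂ ∣ ≡ 2
    × A₂ ∖ (A₁ ∪ A₃) ≡ ⊥
    × 2 * betweenSize G (A₁ ∩ A₂) (A₂ ∩ A₃) + 1 ≡ k
lemma4p7 G s k loopless connected k≥2 _ I₁ I₂ I₃ m₁ m₂ m₃ I₁≢I₂ I₂≢I₃ I₁≢I₃ (e₁₂ , e₁₂∈) (e₃₂ , e₃₂∈)
         A₁ A₂ A₃ D₁ D₂ D₃ I₁→A₁ I₂→A₂ I₃→A₃ =
  (s-to-A₁∩A₂ , s-to-A₃∩A₂) , δA₂-decomposition , ∣I₂∣≡2 , A₂∖[A₁∪A₃]≡⊥ , A₁∩A₂-to-A₂∩A₃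
  where
  configuration : Configuration
  configuration = record
    { G = G ; s = s ; k = k ; loopless = loopless ; connected = connected ; k≥2 = k≥2
    ; I₁ = I₁ ; I₂ = I₂ ; I₃ = I₃ ; m₁ = m₁ ; m₂ = m₂ ; m₃ = m₃
    ; I₁≢I₂ = I₁≢I₂ ; I₃≢I₂ = λ I₃≡I₂ → I₂≢I₃ (sym I₃≡I₂) ; I₁≢I₃ = I₁≢I₃
    ; e₁₂ = e₁₂ ; e₃₂ = e₃₂
    ; e₁₂∈I₁ = proj₁ (x∈p∩q⁻ I₁ I₂ e₁₂∈) ; e₁₂∈I₂ = proj₂ (x∈p∩q⁻ I₁ I₂ e₁₂∈)
    ; e₃₂∈I₃ = proj₂ (x∈p∩q⁻ I₂ I₃ e₃₂∈) ; e₃₂∈I₂ = proj₁ (x∈p∩q⁻ I₂ I₃ e₃₂∈)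
    ; A₁ = A₁ ; A₂ = A₂ ; A₃ = A₃
    ; D₁ = toDangerousᵇ D₁ ; D₂ = toDangerousᵇ D₂ ; D₃ = toDangerousᵇ D₃
    ; I₁→A₁ = I₁→A₁ ; I₂→A₂ = I₂→A₂ ; I₃→A₃ = I₃→A₃ }
  open Conclusions configuration
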